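{- Let $r\ge 1$, $\mathbb A=\{1,\dots,r\}$, and let $t,q$ be indeterminates. Then $$\mathrm{Ferm}(t,q)\times \mathrm{Bos}(t,q)\equiv 1 \pmod{\mathcal I(SF_q)},$$ where $\mathrm{Ferm}(t,q)$, $\mathrm{Bos}(t,q)$, $SF_q$ and $\mathcal I(SF_q)$ are as defined in the context.
   Context: A biword on $\mathbb A$ is a $2\times n$ matrix $\binom{x_1\cdots x_n}{a_1\cdots a_n}$ ($n\ge0$) with entries in $\mathbb A$. The first row is its top word and the second row its bottom word; $n$ is its length. A biword is viewed as a word in biletters $\binom{x_i}{a_i}$, and biwords are multiplied by concatenation; the empty biword is $1$. Let $\mathcal B$ be the set of biwords. Let $K=\mathbb Z[t,t^{ -1},q,q^{ -1}]$ and let $K\langle\langle\mathcal B\rangle\rangle$ be the algebra of formal sums $\sum_\alpha c(\alpha)\alpha$ with $c(\alpha)\in K$. There are finitely many biwords of each length, so these sums can be multiplied. For a word $w=w_1\cdots w_m$, $\mathrm{inv}\,w$ is the number of pairs $i<j$ with $w_i>w_j$, and $\overline w$ is the nondecreasing rearrangement of $w$. For a biword $\alpha=\binom{x_1\cdots x_n}{a_1\cdots a_n}$, $\mathrm{exc}\,\alpha=\#\{i: a_i>x_i\}$. Define $$\mathrm{Bos}(t,q)=\sum_{w\in\mathbb A^*} t^{\mathrm{exc}\binom{\overline w}{w}}q^{\mathrm{inv}\,w}\binom{\overline w}{w}$$ and $$\mathrm{Ferm}(t,q)=\sum_{J\subseteq\mathbb A}(-1)^{|J|}\sum_{\sigma\in\mathfrak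 S_J} t^{\mathrm{exc}\,\alpha_\sigma}(-q)^{ -\mathrm{inv}\,\sigma}\,\alpha_\sigma .$$ Here $J=\{i_1<\dots<i_l\}$, $\mathfrak S_J$ is the group of permutations of $J$, $\alpha_\sigma=\binom{\sigma(i_1)\cdots\sigma(i_l)}{i_1\cdots i_l}$, and $\mathrm{inv}\,\sigma=\mathrm{inv}(\sigma(i_1)\cdots\sigma(i_l))$. The term $J=\emptyset$ contributes $1$. The reduction system $SF_q$ consists of the following rules, for all $x>y$ in $\mathbb A$: - $\binom{xy}{ab}\to\binom{yx}{ba}$ if $a>b$; - $\binom{xy}{ab}\to q\binom{yx}{ba}$ if $a=b$; - $\binom{xy}{ab}\to q^2\binom{yx}{ba}$ if $a<b$. $\mathcal I(SF_q)$ is the two-sided ideal generated by the differences (left side minus right side) of these rules. $E\equiv F\pmod{\mathcal I(SF_q)}$ means that, for every $n$, the (finite) length-$n$ homogeneous component of $E-F$ lies in this ideal. -}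

module Defs where

open import Data.Nat as ℕ using (ℕ; zero; suc)
open import Data.Integer as ℤ using (ℤ; +_; -_)
open import Data.Fin as Fin using (Fin)
open import Data.Fin.Properties using (≤-decTotalOrder)
import Data.Fin.Properties as FinP
import Data.Integer.Properties as ℤP
open import Data.List using (List; []; _∷_; _++_; map; concatMap; length; filter; upTo; sum; allFin)
open import Data.Product using (_×_; _,_; Σ; ∃)
open import Data.Bool using (if_then_else_)
open import Relation.Nullary.Decidable using (⌊_⌋; _×-dec_)
open import Relation.Binary.PropositionalEquality using (_≡_)
import Data.List.Sort.InsertionSort as InsSort

-- A biletter (x over a) is the pair (x , a): x top letter, a bottom letter.

Biletter : ℕ → Set
Biletter r = Fin r × Fin r

Biword : ℕ → Set
Biword r = List (Biletter r)

countB : {A : Set} → (A → Data.Bool.Bool) → List A → ℕ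
countB p [] = 0
countB p (x ∷ xs) = if p x then suc (countB p xs) else countB p xs

inv : {r : ℕ} → List (Fin r) → ℕ
inv [] = 0
inv (x ∷ xs) = countB (λ y → ⌊ y Fin.<? x ⌋) xs ℕ.+ inv xs

exc : {r : ℕ} → Biword r → ℕ
exc = countB (λ { (x , a) → ⌊ x Fin.<? a ⌋ })

sortW : {r : ℕ} → List (Fin r) → List (Fin r)
sortW {r} = InsSort.sort (≤-decTotalOrder r)

-- biword with given top and bottom words (zipped; used on equal lengths)
bi : {r : ℕ} → List (Fin r) → List (Fin r) → Biword r
bi [] _ = []
bi (_ ∷ _) [] = []
bi (x ∷ xs) (a ∷ as) = (x , a) ∷ bi xs as

-- Elements of K⟨⟨B⟩⟩ restricted to finitely many terms:
-- a finite formal sum of terms  c · t^i · q^j · α  with c,i,j ∈ ℤ, α ∈ B.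
-- This represents elements of K⟨B⟩ with K = ℤ[t,t⁻¹,q,q⁻¹].

record Term (r : ℕ) : Set where
  constructor term
  field
    coef : ℤ
    texp : ℤ
    qexp : ℤ
    word : Biword r

Poly : ℕ → Set
Poly r = List (Term r)

coeff : {r : ℕ} → Poly r → ℤ → ℤ → Biword r → ℤ
coeff [] i j α = + 0
coeff (term c i' j' α' ∷ P) i j α =
  if ⌊ (i' ℤ.≟ i) ×-dec ((j' ℤ.≟ j) ×-dec Data.List.Properties.≡-dec
         (Data.Product.Properties.≡-dec FinP._≟_ FinP._≟_) α' α) ⌋
  then c ℤ.+ coeff P i j α
  else coeff P i j α
  where import Data.List.Properties
        import Data.Product.Properties

_≈P_ : {r : ℕ} → Poly r → Poly r → Set
P ≈P Q = ∀ i j α → coeff P i j α ≡ coeff Q i j α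

negP : {r : ℕ} → Poly r → Poly r
negP = map (λ { (term c i j α) → term (ℤ.- c) i j α })

_-P_ : {r : ℕ} → Poly r → Poly r → Poly r
P -P Q = P ++ negP Q

_*P_ : {r : ℕ} → Poly r → Poly r → Poly r
P *P Q = concatMap (λ { (term c i j α) →
           map (λ { (term d k l β) → term (c ℤ.* d) (i ℤ.+ k) (j ℤ.+ l) (α ++ β) }) Q }) P

sandwich : {r : ℕ} → Biword r → Poly r → Biword r → Poly r
sandwich u P v = map (λ { (term c i j α) → term c i j (u ++ α ++ v) }) P

scale : {r : ℕ} → ℤ → ℤ → ℤ → Poly r → Poly r
scale c i j = map (λ { (term d k l α) → term (c ℤ.* d) (i ℤ.+ k) (j ℤ.+ l) α })

-- The reduction system SF_q: for x > y and letters a, b,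
--   (x y over a b) → q^e (y x over b a),  e = 0 if a > b, 1 if a = b, 2 if a < b.

qPow : {r : ℕ} → Fin r → Fin r → ℤ
qPow a b with Fin.compare a b
... | Fin.less _ _    = + 2
... | Fin.equal _     = + 1
... | Fin.greater _ _ = + 0

record RuleInst (r : ℕ) : Set where
  constructor rule
  field
    x y a b : Fin r
    x>y : y Fin.< x

ruleDiff : {r : ℕ} → RuleInst r → Poly r
ruleDiff (rule x y a b _) =
  term (+ 1) (+ 0) (+ 0) ((x , a) ∷ (y , b) ∷ [])
  ∷ term (- (+ 1)) (+ 0) (qPow a b) ((y , b) ∷ (x , a) ∷ [])
  ∷ []

-- an element of the two-sided ideal I(SF_q) spanned by the K-multiples of
-- u · (lhs − rhs) · v ; K-multiples are finite sums of monomials c t^i q^j.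
record IdealGen (r : ℕ) : Set where
  constructor igen
  field
    c i j : ℤ
    left  : Biword r
    ρ     : RuleInst r
    right : Biword r

genPoly : {r : ℕ} → IdealGen r → Poly r
genPoly (igen c i j u ρ v) = scale c i j (sandwich u (ruleDiff ρ) v)

InIdeal : {r : ℕ} → Poly r → Set
InIdeal {r} P = Σ (List (IdealGen r)) λ gs → P ≈P concatMap genPoly gs

words : (r n : ℕ) → List (List (Fin r))
words r zero = [] ∷ []
words r (suc n) = concatMap (λ x → map (x ∷_) (words r n)) (allFin r)

-- all subsets of a list, each as a sublist (so subsets of allFin r are
-- listed increasingly: J = {i₁ < … < i_l})
subsets : {A : Set} → List A → List (List A)
subsets [] = [] ∷ []
subsets (x ∷ xs) = subsets xs ++ map (x ∷_) (subsets xs)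

insertions : {A : Set} → A → List A → List (List A)
insertions x [] = (x ∷ []) ∷ []
insertions x (y ∷ ys) = (x ∷ y ∷ ys) ∷ map (y ∷_) (insertions x ys)

-- all rearrangements of a list: for J = i₁<…<i_l these are exactly the
-- words σ(i₁)…σ(i_l), σ ∈ 𝔖_J (one each)
perms : {A : Set} → List A → List (List A)
perms [] = [] ∷ []
perms (x ∷ xs) = concatMap (insertions x) (perms xs)

sign : ℕ → ℤ
sign zero = + 1
sign (suc n) = - sign n

Bos : (r n : ℕ) → Poly r
Bos r n = map (λ w → let α = bi (sortW w) w in
                 term (+ 1) (+ exc α) (+ inv w) α) (words r n)

-- Ferm_n = Σ_{J ⊆ 𝔸, |J| = n} (-1)^{|J|} Σ_{σ ∈ 𝔖_J} t^{exc α_σ} (-q)^{-inv σ} α_σ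
-- with (-q)^{-k} = (-1)^k q^{-k}.
Ferm : (r n : ℕ) → Poly r
Ferm r n = concatMap (λ J →
   if ⌊ length J ℕ.≟ n ⌋
   then map (λ s → let α = bi s J in
          term (sign (length J) ℤ.* sign (inv s)) (+ exc α) (- (+ inv s)) α) (perms J)
   else []) (subsets (allFin r))

FermBos : (r n : ℕ) → Poly r
FermBos r n = concatMap (λ k → Ferm r k *P Bos r (n ℕ.∸ k)) (upTo (suc n))

oneP : (r n : ℕ) → Poly r
oneP r zero = term (+ 1) (+ 0) (+ 0) [] ∷ []
oneP r (suc n) = []

{-# OPTIONS --safe #-}
-- Modulo I(SF_q) every monomial t^i q^j α equals t^i q^(j - ε α + ε ᾱ) ᾱ, where ᾱ is α
-- stably sorted by its top letters and ε α = inv (bottom α) - inv (top α): a rule swaps a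
-- descent of the top word and changes ε by exactly the power of q it produces. The term of
-- Ferm × Bos given by J = {i₁ < ⋯ < i_l}, σ ∈ 𝔖_J and a word w becomes ± t^(exc β) q^(ε β) β,
-- with β the sorted form of α_σ (w̄ over w). For fixed β and J at most one (σ, w) leads to β,
-- and one does exactly when the map sending x to the first bottom letter of row x of β
-- permutes J; the sign is then (-1)^|J| sgn σ = (-1)^(number of cycles). If β ≠ 1 is reached
-- at all, it is balanced, so that map has a cycle C, and J ↦ J △ C is a sign-reversing
-- involution on these J. Only β = 1 survives, in length 0, with coefficient 1.

module Submission where

open import Defs
open import Data.Bool using (Bool; true; false; if_then_else_; not; _xor_)
import Data.Bool.Properties as Boolₚ
open import Data.Empty using (⊥; ⊥-elim)
open import Data.Fin as Fin using (Fin)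
import Data.Fin.Properties as Finₚ
open import Data.Integer as ℤ using (ℤ; +_; -_; _+_; _-_; _*_; 0ℤ; 1ℤ; -1ℤ)
import Data.Integer.Properties as ℤₚ
open import Data.Integer.Tactic.RingSolver using (solve-∀)
open import Data.List as List using (List; []; _∷_; _++_; [_]; map; concatMap; length; allFin; upTo; filterᵇ; head; drop)
import Data.List.Properties as Listₚ
open import Data.List.Membership.Propositional using (_∈_; _∉_; find; lose)
import Data.List.Membership.DecPropositional as DecMembership
open import Data.List.Membership.Propositional.Properties
open import Data.List.Relation.Binary.Permutation.Propositional
  using (_↭_; prep; swap; ↭-refl; ↭-sym; ↭-trans; ↭⇒↭ₛ; module PermutationReasoning)
open import Data.List.Relation.Binary.Permutation.Propositional.Properties
import Data.List.Relation.Binary.Permutation.Setoid.Properties as PermutationSetoidₚ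
open import Data.List.Relation.Binary.Pointwise using (Pointwise-≡⇒≡)
open import Data.List.Relation.Unary.All as All using (All; []; _∷_)
open import Data.List.Relation.Unary.AllPairs as AllPairs using (AllPairs; []; _∷_)
import Data.List.Relation.Unary.AllPairs.Properties as AllPairsₚ
open import Data.List.Relation.Unary.Any as Any using (Any; here; there)
open import Data.List.Relation.Unary.Sorted.TotalOrder.Properties using (AllPairs⇒Sorted; Sorted⇒AllPairs; ↗↭↗⇒≋)
open import Data.List.Relation.Unary.Unique.Propositional as Unique using (Unique)
import Data.List.Relation.Unary.Unique.Propositional.Properties as Uniqueₚ
import Data.List.Sort.InsertionSort.Base as InsertionSort
import Data.List.Sort.InsertionSort.Properties as InsertionSortₚ
open import Data.Maybe using (fromMaybe)
open import Data.Nat as ℕ using (ℕ; zero; suc; _≤_)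
open import Data.Nat.GeneralisedArithmetic using (iterate)
import Data.Nat.Properties as ℕₚ
open import Data.Nat.Tactic.RingSolver using () renaming (solve-∀ to solveℕ-∀)
open import Data.Product using (_×_; _,_; ∃; proj₁; proj₂)
import Data.Product.Properties as Productₚ
open import Data.Sum using (_⊎_; inj₁; inj₂; [_,_]′)
open import Function using (_∘_; _⇔_; mk⇔)
open import Relation.Binary.Definitions using (DecidableEquality; tri<; tri≈; tri>)
open import Relation.Binary.PropositionalEquality hiding ([_])
open import Relation.Nullary using (Dec; yes; no; ¬_; does)
open import Relation.Nullary.Decidable using (⌊_⌋; _×-dec_; does-⇔; isYes≗does)

-- Finite sums

module _ {A : Set} where

  sumℤ : List A → (A → ℤ) → ℤ
  sumℤ [] f = 0ℤ
  sumℤ (x ∷ xs) f = f x + sumℤ xs f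

  sumℤ-++ : ∀ xs ys (f : A → ℤ) → sumℤ (xs ++ ys) f ≡ sumℤ xs f + sumℤ ys f
  sumℤ-++ [] ys f = sym (ℤₚ.+-identityˡ _)
  sumℤ-++ (x ∷ xs) ys f = trans (cong (λ s → f x + s) (sumℤ-++ xs ys f)) (sym (ℤₚ.+-assoc (f x) _ _))

  sumℤ-cong : ∀ xs {f g : A → ℤ} → (∀ x → x ∈ xs → f x ≡ g x) → sumℤ xs f ≡ sumℤ xs g
  sumℤ-cong [] f≡g = refl
  sumℤ-cong (x ∷ xs) f≡g = cong₂ _+_ (f≡g x (here refl)) (sumℤ-cong xs (λ y y∈ → f≡g y (there y∈)))

  sumℤ-zero : ∀ xs {f : A → ℤ} → (∀ x → x ∈ xs → f x ≡ 0ℤ) → sumℤ xs f ≡ 0ℤ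
  sumℤ-zero [] f≡0 = refl
  sumℤ-zero (x ∷ xs) f≡0 = cong₂ _+_ (f≡0 x (here refl)) (sumℤ-zero xs (λ y y∈ → f≡0 y (there y∈)))

  sumℤ-+ : ∀ xs (f g : A → ℤ) → sumℤ xs (λ x → f x + g x) ≡ sumℤ xs f + sumℤ xs g
  sumℤ-+ [] f g = refl
  sumℤ-+ (x ∷ xs) f g rewrite sumℤ-+ xs f g = shuffle (f x) (g x) (sumℤ xs f) (sumℤ xs g)
    where shuffle : ∀ a b c d → (a + b) + (c + d) ≡ (a + c) + (b + d)
          shuffle = solve-∀

  sumℤ-neg : ∀ xs (f : A → ℤ) → sumℤ xs (λ x → - f x) ≡ - sumℤ xs f
  sumℤ-neg [] f = refl
  sumℤ-neg (x ∷ xs) f rewrite sumℤ-neg xs f = sym (ℤₚ.neg-distrib-+ (f x) (sumℤ xs f))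

  sumℤ-*ˡ : ∀ xs (k : ℤ) (f : A → ℤ) → sumℤ xs (λ x → k * f x) ≡ k * sumℤ xs f
  sumℤ-*ˡ [] k f = sym (ℤₚ.*-zeroʳ k)
  sumℤ-*ˡ (x ∷ xs) k f rewrite sumℤ-*ˡ xs k f = sym (ℤₚ.*-distribˡ-+ k (f x) (sumℤ xs f))

  sumℤ-single : ∀ xs (a : A) (f : A → ℤ) → Unique xs → a ∈ xs →
                (∀ x → x ∈ xs → x ≢ a → f x ≡ 0ℤ) → sumℤ xs f ≡ f a
  sumℤ-single (x ∷ xs) a f (x∉xs ∷ _) (here refl) f≡0 =
    trans (cong (λ s → f x + s) (sumℤ-zero xs (λ y y∈ → f≡0 y (there y∈) (λ { refl → All.lookup x∉xs y∈ refl }))))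
          (ℤₚ.+-identityʳ (f x))
  sumℤ-single (x ∷ xs) a f (x∉xs ∷ u) (there a∈) f≡0 =
    trans (cong₂ _+_ (f≡0 x (here refl) (λ { refl → All.lookup x∉xs a∈ refl }))
                     (sumℤ-single xs a f u a∈ (λ y y∈ → f≡0 y (there y∈))))
          (ℤₚ.+-identityˡ (f a))

module _ {A B : Set} where

  sumℤ-map : ∀ xs (g : A → B) (f : B → ℤ) → sumℤ (map g xs) f ≡ sumℤ xs (f ∘ g)
  sumℤ-map [] g f = refl
  sumℤ-map (x ∷ xs) g f = cong (λ s → f (g x) + s) (sumℤ-map xs g f)

  sumℤ-concatMap : ∀ xs (g : A → List B) (f : B → ℤ) →
                   sumℤ (concatMap g xs) f ≡ sumℤ xs (λ x → sumℤ (g x) f)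
  sumℤ-concatMap [] g f = refl
  sumℤ-concatMap (x ∷ xs) g f =
    trans (sumℤ-++ (g x) (concatMap g xs) f) (cong (λ s → sumℤ (g x) f + s) (sumℤ-concatMap xs g f))

  sumℤ-comm : ∀ xs ys (h : A → B → ℤ) →
              sumℤ xs (λ x → sumℤ ys (h x)) ≡ sumℤ ys (λ y → sumℤ xs (λ x → h x y))
  sumℤ-comm [] ys h = sym (sumℤ-zero ys (λ _ _ → refl))
  sumℤ-comm (x ∷ xs) ys h rewrite sumℤ-comm xs ys h = sym (sumℤ-+ ys (h x) (λ y → sumℤ xs (λ x′ → h x′ y)))

module _ {A : Set} where

  sumℕ : List A → (A → ℕ) → ℕ
  sumℕ [] f = 0
  sumℕ (x ∷ xs) f = f x ℕ.+ sumℕ xs f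

  sumℕ-++ : ∀ xs ys (f : A → ℕ) → sumℕ (xs ++ ys) f ≡ sumℕ xs f ℕ.+ sumℕ ys f
  sumℕ-++ [] ys f = refl
  sumℕ-++ (x ∷ xs) ys f rewrite sumℕ-++ xs ys f = sym (ℕₚ.+-assoc (f x) _ _)

  sumℕ-cong : ∀ xs {f g : A → ℕ} → (∀ x → x ∈ xs → f x ≡ g x) → sumℕ xs f ≡ sumℕ xs g
  sumℕ-cong [] f≡g = refl
  sumℕ-cong (x ∷ xs) f≡g = cong₂ ℕ._+_ (f≡g x (here refl)) (sumℕ-cong xs (λ y y∈ → f≡g y (there y∈)))

  sumℕ-zero : ∀ xs {f : A → ℕ} → (∀ x → x ∈ xs → f x ≡ 0) → sumℕ xs f ≡ 0
  sumℕ-zero [] f≡0 = refl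
  sumℕ-zero (x ∷ xs) f≡0 = cong₂ ℕ._+_ (f≡0 x (here refl)) (sumℕ-zero xs (λ y y∈ → f≡0 y (there y∈)))

  sumℕ-+ : ∀ xs (f g : A → ℕ) → sumℕ xs (λ x → f x ℕ.+ g x) ≡ sumℕ xs f ℕ.+ sumℕ xs g
  sumℕ-+ [] f g = refl
  sumℕ-+ (x ∷ xs) f g rewrite sumℕ-+ xs f g = shuffle (f x) (g x) (sumℕ xs f) (sumℕ xs g)
    where shuffle : ∀ a b c d → (a ℕ.+ b) ℕ.+ (c ℕ.+ d) ≡ (a ℕ.+ c) ℕ.+ (b ℕ.+ d)
          shuffle = solveℕ-∀

  sumℕ-↭ : ∀ {xs ys} (f : A → ℕ) → xs ↭ ys → sumℕ xs f ≡ sumℕ ys f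
  sumℕ-↭ f _↭_.refl = refl
  sumℕ-↭ f (prep x p) = cong (f x ℕ.+_) (sumℕ-↭ f p)
  sumℕ-↭ f (swap x y p) = trans (exchange (f x) (f y) _) (cong (λ s → f y ℕ.+ (f x ℕ.+ s)) (sumℕ-↭ f p))
    where exchange : ∀ a b c → a ℕ.+ (b ℕ.+ c) ≡ b ℕ.+ (a ℕ.+ c)
          exchange = solveℕ-∀
  sumℕ-↭ f (_↭_.trans p q) = trans (sumℕ-↭ f p) (sumℕ-↭ f q)

module _ {A B : Set} where

  sumℕ-map : ∀ xs (g : A → B) (f : B → ℕ) → sumℕ (map g xs) f ≡ sumℕ xs (f ∘ g)
  sumℕ-map [] g f = refl
  sumℕ-map (x ∷ xs) g f = cong (f (g x) ℕ.+_) (sumℕ-map xs g f)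

  sumℕ-comm : ∀ xs ys (h : A → B → ℕ) →
              sumℕ xs (λ x → sumℕ ys (h x)) ≡ sumℕ ys (λ y → sumℕ xs (λ x → h x y))
  sumℕ-comm [] ys h = sym (sumℕ-zero ys (λ _ _ → refl))
  sumℕ-comm (x ∷ xs) ys h rewrite sumℕ-comm xs ys h = sym (sumℕ-+ ys (h x) (λ y → sumℕ xs (λ x′ → h x′ y)))

module _ {P : Set} where

  ⌊⌋-yes : (P? : Dec P) → P → ⌊ P? ⌋ ≡ true
  ⌊⌋-yes (yes _) _ = refl
  ⌊⌋-yes (no ¬p) p = ⊥-elim (¬p p)

  ⌊⌋-no : (P? : Dec P) → ¬ P → ⌊ P? ⌋ ≡ false
  ⌊⌋-no (yes p) ¬p = ⊥-elim (¬p p)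
  ⌊⌋-no (no _) _ = refl

  ⌊⌋-⇔ : {Q : Set} → P ⇔ Q → (P? : Dec P) (Q? : Dec Q) → ⌊ P? ⌋ ≡ ⌊ Q? ⌋
  ⌊⌋-⇔ P⇔Q P? Q? = trans (isYes≗does P?) (trans (does-⇔ P⇔Q P? Q?) (sym (isYes≗does Q?)))

  module _ {A : Set} {x y : A} where

    if-yes : (P? : Dec P) → P → (if ⌊ P? ⌋ then x else y) ≡ x
    if-yes P? p rewrite ⌊⌋-yes P? p = refl

    if-no : (P? : Dec P) → ¬ P → (if ⌊ P? ⌋ then x else y) ≡ y
    if-no P? ¬p rewrite ⌊⌋-no P? ¬p = refl

-- Formal sums modulo I(SF_q)

module _ {r : ℕ} where

  _≟ᵇ_ : DecidableEquality (Biword r)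
  _≟ᵇ_ = Listₚ.≡-dec (Productₚ.≡-dec Finₚ._≟_ Finₚ._≟_)

  monomial : ℤ → ℤ → ℤ → Biword r → Poly r
  monomial c i j α = term c i j α ∷ []

  coeffTerm : Term r → ℤ → ℤ → Biword r → ℤ
  coeffTerm (term c i′ j′ α′) i j α =
    if ⌊ (i′ ℤ.≟ i) ×-dec ((j′ ℤ.≟ j) ×-dec (α′ ≟ᵇ α)) ⌋ then c else 0ℤ

  coeff-sum : ∀ (P : Poly r) i j α → coeff P i j α ≡ sumℤ P (λ t → coeffTerm t i j α)
  coeff-sum [] i j α = refl
  coeff-sum (term c i′ j′ α′ ∷ P) i j α
    rewrite coeff-sum P i j α
    with ⌊ (i′ ℤ.≟ i) ×-dec ((j′ ℤ.≟ j) ×-dec (α′ ≟ᵇ α)) ⌋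
  ... | true  = refl
  ... | false = sym (ℤₚ.+-identityˡ _)

  coeff-++ : ∀ (P Q : Poly r) i j α → coeff (P ++ Q) i j α ≡ coeff P i j α + coeff Q i j α
  coeff-++ P Q i j α rewrite coeff-sum (P ++ Q) i j α | coeff-sum P i j α | coeff-sum Q i j α =
    sumℤ-++ P Q _

  coeffTerm-neg : ∀ c i′ j′ α′ i j (α : Biword r) →
                  coeffTerm (term (- c) i′ j′ α′) i j α ≡ - coeffTerm (term c i′ j′ α′) i j α
  coeffTerm-neg c i′ j′ α′ i j α with ⌊ (i′ ℤ.≟ i) ×-dec ((j′ ℤ.≟ j) ×-dec (α′ ≟ᵇ α)) ⌋
  ... | true  = refl
  ... | false = refl

  coeff-negP : ∀ (P : Poly r) i j α → coeff (negP P) i j α ≡ - coeff P i j α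
  coeff-negP P i j α = begin
    coeff (negP P) i j α                        ≡⟨ coeff-sum (negP P) i j α ⟩
    sumℤ (negP P) (λ t → coeffTerm t i j α)     ≡⟨ sumℤ-map P _ _ ⟩
    sumℤ P _
      ≡⟨ sumℤ-cong P (λ { (term c i′ j′ α′) _ → coeffTerm-neg c i′ j′ α′ i j α }) ⟩
    sumℤ P (λ t → - coeffTerm t i j α)          ≡⟨ sumℤ-neg P _ ⟩
    - sumℤ P (λ t → coeffTerm t i j α)          ≡⟨ cong -_ (coeff-sum P i j α) ⟨
    - coeff P i j α                             ∎
    where open ≡-Reasoning

  coeff-minusP : ∀ (P Q : Poly r) i j α → coeff (P -P Q) i j α ≡ coeff P i j α - coeff Q i j α
  coeff-minusP P Q i j α = trans (coeff-++ P (negP Q) i j α) (cong (λ s → coeff P i j α + s) (coeff-negP Q i j α))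

  idealSum : List (IdealGen r) → Poly r
  idealSum = concatMap genPoly

  coeff-idealSum-++ : ∀ gs hs i j α →
    coeff (idealSum (gs ++ hs)) i j α ≡ coeff (idealSum gs) i j α + coeff (idealSum hs) i j α
  coeff-idealSum-++ gs hs i j α =
    trans (cong (λ P → coeff P i j α) (Listₚ.concatMap-++ genPoly gs hs)) (coeff-++ (idealSum gs) (idealSum hs) i j α)

  record _≈ᴵ_ (P Q : Poly r) : Set where
    constructor mk≈ᴵ
    field inIdeal : InIdeal (P -P Q)

  infix 4 _≈ᴵ_

  ≈P⇒≈ᴵ : {P Q : Poly r} → P ≈P Q → P ≈ᴵ Q
  ≈P⇒≈ᴵ {P} {Q} P≈Q = mk≈ᴵ ([] , λ i j α →
    trans (coeff-minusP P Q i j α) (trans (cong (_- coeff Q i j α) (P≈Q i j α)) (ℤₚ.+-inverseʳ (coeff Q i j α))))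

  ≈ᴵ-refl : {P : Poly r} → P ≈ᴵ P
  ≈ᴵ-refl = ≈P⇒≈ᴵ (λ _ _ _ → refl)

  ≈ᴵ-trans : {P Q R : Poly r} → P ≈ᴵ Q → Q ≈ᴵ R → P ≈ᴵ R
  ≈ᴵ-trans {P} {Q} {R} (mk≈ᴵ (gs , P-Q≈gs)) (mk≈ᴵ (hs , Q-R≈hs)) = mk≈ᴵ (gs ++ hs , λ i j α → begin
    coeff (P -P R) i j α                                        ≡⟨ coeff-minusP P R i j α ⟩
    coeff P i j α - coeff R i j α                               ≡⟨ telescope (coeff P i j α) (coeff Q i j α) (coeff R i j α) ⟩
    (coeff P i j α - coeff Q i j α) + (coeff Q i j α - coeff R i j α)
      ≡⟨ cong₂ _+_ (trans (sym (coeff-minusP P Q i j α)) (P-Q≈gs i j α)) (trans (sym (coeff-minusP Q R i j α)) (Q-R≈hs i j α)) ⟩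
    coeff (idealSum gs) i j α + coeff (idealSum hs) i j α       ≡⟨ coeff-idealSum-++ gs hs i j α ⟨
    coeff (idealSum (gs ++ hs)) i j α                           ∎)
    where
      open ≡-Reasoning
      telescope : ∀ a b c → a - c ≡ (a - b) + (b - c)
      telescope = solve-∀

  ≈ᴵ-++ : {P P′ Q Q′ : Poly r} → P ≈ᴵ P′ → Q ≈ᴵ Q′ → P ++ Q ≈ᴵ P′ ++ Q′
  ≈ᴵ-++ {P} {P′} {Q} {Q′} (mk≈ᴵ (gs , P-P′≈gs)) (mk≈ᴵ (hs , Q-Q′≈hs)) = mk≈ᴵ (gs ++ hs , λ i j α → begin
    coeff ((P ++ Q) -P (P′ ++ Q′)) i j α
      ≡⟨ trans (coeff-minusP (P ++ Q) (P′ ++ Q′) i j α) (cong₂ _-_ (coeff-++ P Q i j α) (coeff-++ P′ Q′ i j α)) ⟩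
    (coeff P i j α + coeff Q i j α) - (coeff P′ i j α + coeff Q′ i j α)
      ≡⟨ regroup (coeff P i j α) (coeff Q i j α) (coeff P′ i j α) (coeff Q′ i j α) ⟩
    (coeff P i j α - coeff P′ i j α) + (coeff Q i j α - coeff Q′ i j α)
      ≡⟨ cong₂ _+_ (trans (sym (coeff-minusP P P′ i j α)) (P-P′≈gs i j α)) (trans (sym (coeff-minusP Q Q′ i j α)) (Q-Q′≈hs i j α)) ⟩
    coeff (idealSum gs) i j α + coeff (idealSum hs) i j α
      ≡⟨ coeff-idealSum-++ gs hs i j α ⟨
    coeff (idealSum (gs ++ hs)) i j α ∎)
    where
      open ≡-Reasoning
      regroup : ∀ a b c d → (a + b) - (c + d) ≡ (a - c) + (b - d)
      regroup = solve-∀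

  ≈ᴵ-rule : ∀ c i j (u v : Biword r) x y a b → (x>y : y Fin.< x) →
            monomial c i j (u ++ (x , a) ∷ (y , b) ∷ v) ≈ᴵ monomial c i (j + qPow a b) (u ++ (y , b) ∷ (x , a) ∷ v)
  ≈ᴵ-rule c i j u v x y a b x>y = mk≈ᴵ (igen c i j u (rule x y a b x>y) v ∷ [] , λ i′ j′ α →
    cong (λ P → coeff P i′ j′ α) (sym generator≡))
    where
      generator≡ : idealSum (igen c i j u (rule x y a b x>y) v ∷ [])
                 ≡ monomial c i j (u ++ (x , a) ∷ (y , b) ∷ v) -P monomial c i (j + qPow a b) (u ++ (y , b) ∷ (x , a) ∷ v)
      generator≡ rewrite ℤₚ.*-identityʳ c | ℤₚ.+-identityʳ i | ℤₚ.+-identityʳ j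
                       | ℤₚ.*-comm c -1ℤ | ℤₚ.-1*i≡-i c = refl

-- Sorting a biword by its top word

𝟙 : Bool → ℕ
𝟙 true = 1
𝟙 false = 0

module _ {A : Set} (p : A → Bool) where

  countB-∷ : ∀ y ys → countB p (y ∷ ys) ≡ 𝟙 (p y) ℕ.+ countB p ys
  countB-∷ y ys with p y
  ... | true = refl
  ... | false = refl

  countB-++ : ∀ xs ys → countB p (xs ++ ys) ≡ countB p xs ℕ.+ countB p ys
  countB-++ [] ys = refl
  countB-++ (x ∷ xs) ys rewrite countB-∷ x (xs ++ ys) | countB-∷ x xs | countB-++ xs ys =
    sym (ℕₚ.+-assoc (𝟙 (p x)) _ _)

  private
    countB-∷-cong : ∀ z xs ys → countB p xs ≡ countB p ys → countB p (z ∷ xs) ≡ countB p (z ∷ ys)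
    countB-∷-cong z xs ys eq rewrite countB-∷ z xs | countB-∷ z ys = cong (𝟙 (p z) ℕ.+_) eq

    countB-swap : ∀ x y ys → countB p (x ∷ y ∷ ys) ≡ countB p (y ∷ x ∷ ys)
    countB-swap x y ys rewrite countB-∷ x (y ∷ ys) | countB-∷ y (x ∷ ys) | countB-∷ y ys | countB-∷ x ys =
      exchange (𝟙 (p x)) (𝟙 (p y)) (countB p ys)
      where exchange : ∀ a b c → a ℕ.+ (b ℕ.+ c) ≡ b ℕ.+ (a ℕ.+ c)
            exchange = solveℕ-∀

  countB-↭ : ∀ {xs ys} → xs ↭ ys → countB p xs ≡ countB p ys
  countB-↭ _↭_.refl = refl
  countB-↭ {x ∷ xs} {x ∷ ys} (prep x xs↭ys) = countB-∷-cong x xs ys (countB-↭ xs↭ys)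
  countB-↭ {x ∷ y ∷ xs} {y ∷ x ∷ ys} (swap x y xs↭ys) =
    trans (countB-swap x y xs) (countB-∷-cong y (x ∷ xs) (x ∷ ys) (countB-∷-cong x xs ys (countB-↭ xs↭ys)))
  countB-↭ (_↭_.trans {ys = ys} p₁ p₂) = trans (countB-↭ p₁) (countB-↭ {ys} p₂)

module _ {r : ℕ} where

  ⟦_<_⟧ : Fin r → Fin r → ℕ
  ⟦ a < b ⟧ = 𝟙 ⌊ a Fin.<? b ⌋

  ⟦<⟧-yes : ∀ {a b} → a Fin.< b → ⟦ a < b ⟧ ≡ 1
  ⟦<⟧-yes a<b = cong 𝟙 (⌊⌋-yes (_ Fin.<? _) a<b)

  ⟦<⟧-no : ∀ {a b} → ¬ a Fin.< b → ⟦ a < b ⟧ ≡ 0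
  ⟦<⟧-no a≮b = cong 𝟙 (⌊⌋-no (_ Fin.<? _) a≮b)

  countLess : Fin r → List (Fin r) → ℕ
  countLess x = countB (λ y → ⌊ y Fin.<? x ⌋)

  inv-swap : ∀ (u : List (Fin r)) x y v →
             inv (u ++ x ∷ y ∷ v) ℕ.+ ⟦ x < y ⟧ ≡ inv (u ++ y ∷ x ∷ v) ℕ.+ ⟦ y < x ⟧
  inv-swap [] x y v
    rewrite countB-∷ (λ z → ⌊ z Fin.<? x ⌋) y v | countB-∷ (λ z → ⌊ z Fin.<? y ⌋) x v =
    exchange ⟦ y < x ⟧ ⟦ x < y ⟧ (countLess x v) (countLess y v) (inv v)
    where exchange : ∀ a b c d e → a ℕ.+ c ℕ.+ (d ℕ.+ e) ℕ.+ b ≡ b ℕ.+ d ℕ.+ (c ℕ.+ e) ℕ.+ a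
          exchange = solveℕ-∀
  inv-swap (z ∷ u) x y v
    rewrite countB-↭ (λ w → ⌊ w Fin.<? z ⌋) (++⁺ˡ u (swap x y (↭-refl {x = v}))) =
    trans (ℕₚ.+-assoc (countLess z (u ++ y ∷ x ∷ v)) _ _)
          (trans (cong (countLess z (u ++ y ∷ x ∷ v) ℕ.+_) (inv-swap u x y v))
                 (sym (ℕₚ.+-assoc (countLess z (u ++ y ∷ x ∷ v)) _ _)))

  inv-swap-descent : ∀ (u v : List (Fin r)) {x y} → y Fin.< x →
               inv (u ++ x ∷ y ∷ v) ≡ inv (u ++ y ∷ x ∷ v) ℕ.+ 1
  inv-swap-descent u v {x} {y} y<x = begin
    inv (u ++ x ∷ y ∷ v)               ≡⟨ ℕₚ.+-identityʳ _ ⟨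
    inv (u ++ x ∷ y ∷ v) ℕ.+ 0         ≡⟨ cong (inv (u ++ x ∷ y ∷ v) ℕ.+_) (⟦<⟧-no (Finₚ.<-asym y<x)) ⟨
    inv (u ++ x ∷ y ∷ v) ℕ.+ ⟦ x < y ⟧ ≡⟨ inv-swap u x y v ⟩
    inv (u ++ y ∷ x ∷ v) ℕ.+ ⟦ y < x ⟧ ≡⟨ cong (inv (u ++ y ∷ x ∷ v) ℕ.+_) (⟦<⟧-yes y<x) ⟩
    inv (u ++ y ∷ x ∷ v) ℕ.+ 1         ∎
    where open ≡-Reasoning

  qPow-suc : ∀ (a b : Fin r) → qPow (Fin.suc a) (Fin.suc b) ≡ qPow a b
  qPow-suc a b with Fin.compare a b
  ... | Fin.less _ _ = refl
  ... | Fin.equal _ = refl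
  ... | Fin.greater _ _ = refl

⌊suc<?suc⌋ : ∀ {r} (a b : Fin r) → ⌊ Fin.suc a Fin.<? Fin.suc b ⌋ ≡ ⌊ a Fin.<? b ⌋
⌊suc<?suc⌋ a b = ⌊⌋-⇔ (mk⇔ ℕₚ.≤-pred ℕ.s≤s) (Fin.suc a Fin.<? Fin.suc b) (a Fin.<? b)

qPow-⟦<⟧ : ∀ {r} (a b : Fin r) → qPow a b + + ⟦ b < a ⟧ ≡ 1ℤ + + ⟦ a < b ⟧
qPow-⟦<⟧ Fin.zero Fin.zero = refl
qPow-⟦<⟧ Fin.zero (Fin.suc b) = refl
qPow-⟦<⟧ (Fin.suc a) Fin.zero = refl
qPow-⟦<⟧ (Fin.suc a) (Fin.suc b)
  rewrite qPow-suc a b | ⌊suc<?suc⌋ a b | ⌊suc<?suc⌋ b a = qPow-⟦<⟧ a b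

module _ {r : ℕ} where

  top bottom : Biword r → List (Fin r)
  top = map proj₁
  bottom = map proj₂

  ε : Biword r → ℤ
  ε α = + inv (bottom α) - + inv (top α)

  ε-rule : ∀ (u v : Biword r) x y a b → y Fin.< x →
           ε (u ++ (x , a) ∷ (y , b) ∷ v) + qPow a b ≡ ε (u ++ (y , b) ∷ (x , a) ∷ v)
  ε-rule u v x y a b y<x
    rewrite Listₚ.map-++ proj₁ u ((x , a) ∷ (y , b) ∷ v) | Listₚ.map-++ proj₁ u ((y , b) ∷ (x , a) ∷ v)
          | Listₚ.map-++ proj₂ u ((x , a) ∷ (y , b) ∷ v) | Listₚ.map-++ proj₂ u ((y , b) ∷ (x , a) ∷ v)
          | inv-swap-descent (top u) (top v) y<x =
    linear (inv (bottom u ++ a ∷ b ∷ bottom v)) (inv (bottom u ++ b ∷ a ∷ bottom v))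
           (inv (top u ++ y ∷ x ∷ top v)) ⟦ a < b ⟧ ⟦ b < a ⟧ (qPow a b)
           (inv-swap (bottom u) a b (bottom v)) (qPow-⟦<⟧ a b)
    where
      linear : ∀ (b₁ b₂ t ia ib : ℕ) (q : ℤ) → b₁ ℕ.+ ia ≡ b₂ ℕ.+ ib → q + + ib ≡ 1ℤ + + ia →
               (+ b₁ - + (t ℕ.+ 1)) + q ≡ + b₂ - + t
      linear b₁ b₂ t ia ib q hb hq rewrite ℤₚ.pos-+ t 1 = begin
        (+ b₁ - (+ t + 1ℤ)) + q                                   ≡⟨ expand (+ b₁) (+ t) q (+ ia) (+ ib) ⟩
        (+ b₁ + + ia) + (q + + ib) - + ib - + t - 1ℤ - + ia
          ≡⟨ cong₂ (λ s s′ → s + s′ - + ib - + t - 1ℤ - + ia) hb′ hq ⟩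
        (+ b₂ + + ib) + (1ℤ + + ia) - + ib - + t - 1ℤ - + ia        ≡⟨ collapse (+ b₂) (+ t) (+ ia) (+ ib) ⟩
        + b₂ - + t                                                ∎
        where
          open ≡-Reasoning
          hb′ : + b₁ + + ia ≡ + b₂ + + ib
          hb′ = trans (sym (ℤₚ.pos-+ b₁ ia)) (trans (cong +_ hb) (ℤₚ.pos-+ b₂ ib))
          expand : ∀ b₁ t q ia ib → (b₁ - (t + 1ℤ)) + q ≡ (b₁ + ia) + (q + ib) - ib - t - 1ℤ - ia
          expand = solve-∀
          collapse : ∀ b₂ t ia ib → (b₂ + ib) + (1ℤ + ia) - ib - t - 1ℤ - ia ≡ b₂ - t
          collapse = solve-∀

  monomialε : ℤ → ℤ → ℤ → Biword r → Poly r
  monomialε c i j α = monomial c i (j + ε α) α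

  monomialε-rule : ∀ c i j (u v : Biword r) x y a b → y Fin.< x →
                   monomialε c i j (u ++ (x , a) ∷ (y , b) ∷ v) ≈ᴵ monomialε c i j (u ++ (y , b) ∷ (x , a) ∷ v)
  monomialε-rule c i j u v x y a b y<x =
    subst (λ k → monomialε c i j (u ++ (x , a) ∷ (y , b) ∷ v) ≈ᴵ monomial c i k (u ++ (y , b) ∷ (x , a) ∷ v))
          (trans (ℤₚ.+-assoc j _ _) (cong (λ k → j + k) (ε-rule u v x y a b y<x)))
          (≈ᴵ-rule c i (j + ε (u ++ (x , a) ∷ (y , b) ∷ v)) u v x y a b y<x)

  insertByTop : Biletter r → Biword r → Biword r
  insertByTop b [] = b ∷ []
  insertByTop b (b′ ∷ β) with proj₁ b′ Fin.<? proj₁ b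
  ... | yes _ = b′ ∷ insertByTop b β
  ... | no _ = b ∷ b′ ∷ β

  sortByTop : Biword r → Biword r
  sortByTop [] = []
  sortByTop (b ∷ α) = insertByTop b (sortByTop α)

  monomialε-insertByTop : ∀ c i j (u : Biword r) b β →
                          monomialε c i j (u ++ b ∷ β) ≈ᴵ monomialε c i j (u ++ insertByTop b β)
  monomialε-insertByTop c i j u b [] = ≈ᴵ-refl
  monomialε-insertByTop c i j u (x , a) ((y , b) ∷ β) with y Fin.<? x
  ... | no _ = ≈ᴵ-refl
  ... | yes y<x = ≈ᴵ-trans (monomialε-rule c i j u β x y a b y<x)
    (subst₂ (λ α α′ → monomialε c i j α ≈ᴵ monomialε c i j α′)
            (Listₚ.++-assoc u [ (y , b) ] ((x , a) ∷ β)) (Listₚ.++-assoc u [ (y , b) ] (insertByTop (x , a) β))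
            (monomialε-insertByTop c i j (u ++ [ (y , b) ]) (x , a) β))

  monomialε-sortByTop : ∀ c i j (u α : Biword r) →
                        monomialε c i j (u ++ α) ≈ᴵ monomialε c i j (u ++ sortByTop α)
  monomialε-sortByTop c i j u [] = ≈ᴵ-refl
  monomialε-sortByTop c i j u (b ∷ α) = ≈ᴵ-trans
    (subst₂ (λ α α′ → monomialε c i j α ≈ᴵ monomialε c i j α′)
            (Listₚ.++-assoc u [ b ] α) (Listₚ.++-assoc u [ b ] (sortByTop α))
            (monomialε-sortByTop c i j (u ++ [ b ]) α))
    (monomialε-insertByTop c i j u b (sortByTop α))

  normalise : Term r → Term r
  normalise (term c i j α) = term c i (j - ε α + ε (sortByTop α)) (sortByTop α)

  normalise-≈ᴵ : ∀ (P : Poly r) → P ≈ᴵ map normalise P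
  normalise-≈ᴵ [] = ≈ᴵ-refl
  normalise-≈ᴵ (term c i j α ∷ P) = ≈ᴵ-++ {P = monomial c i j α} term≈ (normalise-≈ᴵ P)
    where
      term≈ : monomial c i j α ≈ᴵ monomial c i (j - ε α + ε (sortByTop α)) (sortByTop α)
      term≈ = subst (λ k → monomial c i k α ≈ᴵ monomial c i (j - ε α + ε (sortByTop α)) (sortByTop α))
                    (cancel j (ε α)) (monomialε-sortByTop c i (j - ε α) [] α)
        where cancel : ∀ a b → a - b + b ≡ a
              cancel = solve-∀

-- Lists without repetition, permutations and subsets

module _ {A : Set} where

  ∉-of-Unique : ∀ {x : A} {xs} → Unique (x ∷ xs) → x ∉ xs
  ∉-of-Unique u x∈xs = All.lookup (Unique.head u) x∈xs refl

  Unique-resp-↭ : ∀ {xs ys : List A} → xs ↭ ys → Unique xs → Unique ys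
  Unique-resp-↭ xs↭ys = PermutationSetoidₚ.Unique-resp-↭ (setoid A) (↭⇒↭ₛ xs↭ys)

  ↭-of-Unique : ∀ (xs ys : List A) → Unique xs → Unique ys →
                (∀ {z} → z ∈ xs → z ∈ ys) → (∀ {z} → z ∈ ys → z ∈ xs) → xs ↭ ys
  ↭-of-Unique [] [] _ _ _ _ = ↭-refl
  ↭-of-Unique [] (y ∷ ys) _ _ _ ys⊆xs with () ← ys⊆xs (here refl)
  ↭-of-Unique (x ∷ xs) ys uxs uys xs⊆ys ys⊆xs with ∈-∃++ (xs⊆ys (here refl))
  ... | u , v , refl = ↭-trans (prep x (↭-of-Unique xs (u ++ v) (Unique.tail uxs) (Unique.tail uxuv) ⊆uv uv⊆)) (↭-sym (shift x u v))
    where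
      uxuv : Unique (x ∷ u ++ v)
      uxuv = Unique-resp-↭ (shift x u v) uys
      ⊆uv : ∀ {z} → z ∈ xs → z ∈ u ++ v
      ⊆uv {z} z∈xs with ∈-++⁻ u (xs⊆ys (there z∈xs))
      ... | inj₁ z∈u = ∈-++⁺ˡ z∈u
      ... | inj₂ (here refl) = ⊥-elim (∉-of-Unique uxs z∈xs)
      ... | inj₂ (there z∈v) = ∈-++⁺ʳ u z∈v
      uv⊆ : ∀ {z} → z ∈ u ++ v → z ∈ xs
      uv⊆ z∈uv with ys⊆xs (∈-resp-↭ (↭-sym (shift x u v)) (there z∈uv))
      ... | here refl = ⊥-elim (∉-of-Unique uxuv z∈uv)
      ... | there z∈xs = z∈xs

  ++-cancelˡ-↭ : ∀ (zs : List A) {xs ys} → zs ++ xs ↭ zs ++ ys → xs ↭ ys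
  ++-cancelˡ-↭ [] p = p
  ++-cancelˡ-↭ (z ∷ zs) p = ++-cancelˡ-↭ zs (drop-∷ p)

module _ {A B : Set} where

  Unique-concatMap : ∀ (xs : List A) (g : A → List B) → Unique xs → (∀ {x} → x ∈ xs → Unique (g x)) →
                     (∀ {x x′ y} → x ∈ xs → x′ ∈ xs → y ∈ g x → y ∈ g x′ → x ≡ x′) → Unique (concatMap g xs)
  Unique-concatMap [] g _ _ _ = []
  Unique-concatMap (x ∷ xs) g uxs ug disjoint =
    Uniqueₚ.++⁺ (ug (here refl))
                (Unique-concatMap xs g (Unique.tail uxs) (ug ∘ there) (λ x∈ x′∈ → disjoint (there x∈) (there x′∈)))
                (λ { (y∈gx , y∈rest) → apart (find (∈-concatMap⁻ g {xs = xs} y∈rest)) y∈gx })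
    where
      apart : ∀ {y} → (∃ λ x′ → x′ ∈ xs × y ∈ g x′) → y ∈ g x → ⊥
      apart (x′ , x′∈xs , y∈gx′) y∈gx with refl ← disjoint (here refl) (there x′∈xs) y∈gx y∈gx′ =
        ∉-of-Unique uxs x′∈xs

module _ {r : ℕ} where

  length-words : ∀ n {w : List (Fin r)} → w ∈ words r n → length w ≡ n
  length-words zero (here refl) = refl
  length-words (suc n) w∈ with _ , _ , w∈′ ← find (∈-concatMap⁻ (λ x → map (x ∷_) (words r n)) {xs = allFin r} w∈)
                           with _ , w′∈ , refl ← ∈-map⁻ _ w∈′ = cong suc (length-words n w′∈)

  ∈-words : ∀ (w : List (Fin r)) → w ∈ words r (length w)
  ∈-words [] = here refl
  ∈-words (x ∷ w) = ∈-concatMap⁺ (λ y → map (y ∷_) (words r (length w))) {xs = allFin r}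
                                  (Any.map (λ { refl → ∈-map⁺ (x ∷_) (∈-words w) }) (∈-allFin x))

  Unique-words : ∀ n → Unique (words r n)
  Unique-words zero = [] ∷ []
  Unique-words (suc n) = Unique-concatMap (allFin r) (λ x → map (x ∷_) (words r n)) (Uniqueₚ.allFin⁺ r)
    (λ _ → Uniqueₚ.map⁺ Listₚ.∷-injectiveʳ (Unique-words n)) same-head
    where
      same-head : ∀ {x x′ w} → x ∈ allFin r → x′ ∈ allFin r →
                  w ∈ map (x ∷_) (words r n) → w ∈ map (x′ ∷_) (words r n) → x ≡ x′
      same-head _ _ w∈ w∈′ with _ , _ , refl ← ∈-map⁻ _ w∈ | _ , _ , eq ← ∈-map⁻ _ w∈′ = Listₚ.∷-injectiveˡ eq

module _ {A : Set} where

  ∈-insertions : ∀ (x : A) u v → u ++ x ∷ v ∈ insertions x (u ++ v)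
  ∈-insertions x [] [] = here refl
  ∈-insertions x [] (y ∷ v) = here refl
  ∈-insertions x (y ∷ u) v = there (∈-map⁺ (y ∷_) (∈-insertions x u v))

  insertions-↭ : ∀ (x : A) ys {s} → s ∈ insertions x ys → s ↭ x ∷ ys
  insertions-↭ x [] (here refl) = ↭-refl
  insertions-↭ x (y ∷ ys) (here refl) = ↭-refl
  insertions-↭ x (y ∷ ys) (there s∈) with _ , s′∈ , refl ← ∈-map⁻ (y ∷_) s∈ =
    ↭-trans (prep y (insertions-↭ x ys s′∈)) (swap y x ↭-refl)

  perms-↭ : ∀ (J : List A) {s} → s ∈ perms J → s ↭ J
  perms-↭ [] (here refl) = ↭-refl
  perms-↭ (x ∷ J) s∈ with ys , ys∈ , s∈′ ← find (∈-concatMap⁻ (insertions x) {xs = perms J} s∈) =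
    ↭-trans (insertions-↭ x ys s∈′) (prep x (perms-↭ J ys∈))

  ∈-perms : ∀ (J : List A) {s} → s ↭ J → s ∈ perms J
  ∈-perms [] s↭[] rewrite ↭-empty-inv s↭[] = here refl
  ∈-perms (x ∷ J) s↭ with u , v , refl ← ∈-∃++ (∈-resp-↭ (↭-sym s↭) (here refl)) =
    ∈-concatMap⁺ (insertions x) {xs = perms J}
      (Any.map (λ { refl → ∈-insertions x u v }) (∈-perms J (drop-mid u [] s↭)))

  module _ (_≟_ : DecidableEquality A) where

    delete : A → List A → List A
    delete x [] = []
    delete x (y ∷ ys) with y ≟ x
    ... | yes _ = ys
    ... | no _ = y ∷ delete x ys

    delete-insertions : ∀ (x : A) ys {s} → x ∉ ys → s ∈ insertions x ys → delete x s ≡ ys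
    delete-insertions x [] x∉ (here refl) with x ≟ x
    ... | yes _ = refl
    ... | no x≢x = ⊥-elim (x≢x refl)
    delete-insertions x (y ∷ ys) x∉ (here refl) with x ≟ x
    ... | yes _ = refl
    ... | no x≢x = ⊥-elim (x≢x refl)
    delete-insertions x (y ∷ ys) x∉ (there s∈) with _ , s′∈ , refl ← ∈-map⁻ (y ∷_) s∈ | y ≟ x
    ... | yes refl = ⊥-elim (x∉ (here refl))
    ... | no _ = cong (y ∷_) (delete-insertions x ys (x∉ ∘ there) s′∈)

    Unique-insertions : ∀ (x : A) ys → x ∉ ys → Unique (insertions x ys)
    Unique-insertions x [] x∉ = [] ∷ []
    Unique-insertions x (y ∷ ys) x∉ =
      All.tabulate (λ s∈ eq → x≢head s∈ eq) ∷ Uniqueₚ.map⁺ Listₚ.∷-injectiveʳ (Unique-insertions x ys (x∉ ∘ there))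
      where
        x≢head : ∀ {s} → s ∈ map (y ∷_) (insertions x ys) → x ∷ y ∷ ys ≢ s
        x≢head s∈ eq with _ , _ , refl ← ∈-map⁻ (y ∷_) s∈ = x∉ (here (Listₚ.∷-injectiveˡ eq))

    Unique-perms : ∀ (J : List A) → Unique J → Unique (perms J)
    Unique-perms [] _ = [] ∷ []
    Unique-perms (x ∷ J) u = Unique-concatMap (perms J) (insertions x) (Unique-perms J (Unique.tail u))
      (λ ys∈ → Unique-insertions x _ (x∉ ys∈))
      (λ ys∈ ys′∈ s∈ s∈′ → trans (sym (delete-insertions x _ (x∉ ys∈) s∈)) (delete-insertions x _ (x∉ ys′∈) s∈′))
      where
        x∉ : ∀ {ys} → ys ∈ perms J → x ∉ ys
        x∉ ys∈ x∈ys = ∉-of-Unique u (∈-resp-↭ (perms-↭ J ys∈) x∈ys)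

module _ {A : Set} where

  subsets-⊆ : ∀ (xs : List A) {J y} → J ∈ subsets xs → y ∈ J → y ∈ xs
  subsets-⊆ [] (here refl) ()
  subsets-⊆ (x ∷ xs) J∈ y∈J with ∈-++⁻ (subsets xs) J∈
  ... | inj₁ J∈′ = there (subsets-⊆ xs J∈′ y∈J)
  ... | inj₂ J∈′ with _ , J′∈ , refl ← ∈-map⁻ (x ∷_) J∈′ with y∈J
  ...   | here y≡x = here y≡x
  ...   | there y∈J′ = there (subsets-⊆ xs J′∈ y∈J′)

  AllPairs-subsets : ∀ {R : A → A → Set} (xs : List A) {J} → AllPairs R xs → J ∈ subsets xs → AllPairs R J
  AllPairs-subsets [] _ (here refl) = []
  AllPairs-subsets (x ∷ xs) (Rx ∷ Rxs) J∈ with ∈-++⁻ (subsets xs) J∈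
  ... | inj₁ J∈′ = AllPairs-subsets xs Rxs J∈′
  ... | inj₂ J∈′ with _ , J′∈ , refl ← ∈-map⁻ (x ∷_) J∈′ =
    All.tabulate (All.lookup Rx ∘ subsets-⊆ xs J′∈) ∷ AllPairs-subsets xs Rxs J′∈

  sumℤ-subsets-[] : ∀ (xs : List A) (F : List A → ℤ) → (∀ J → J ≢ [] → F J ≡ 0ℤ) → sumℤ (subsets xs) F ≡ F []
  sumℤ-subsets-[] [] F F≡0 = ℤₚ.+-identityʳ (F [])
  sumℤ-subsets-[] (x ∷ xs) F F≡0 = begin
    sumℤ (subsets xs ++ map (x ∷_) (subsets xs)) F          ≡⟨ sumℤ-++ (subsets xs) _ F ⟩
    sumℤ (subsets xs) F + sumℤ (map (x ∷_) (subsets xs)) F  ≡⟨ cong₂ _+_ (sumℤ-subsets-[] xs F F≡0) nonempty ⟩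
    F [] + 0ℤ                                               ≡⟨ ℤₚ.+-identityʳ (F []) ⟩
    F []                                                    ∎
    where
      open ≡-Reasoning
      nonempty : sumℤ (map (x ∷_) (subsets xs)) F ≡ 0ℤ
      nonempty = trans (sumℤ-map (subsets xs) (x ∷_) F) (sumℤ-zero (subsets xs) (λ J _ → F≡0 (x ∷ J) (λ ())))

  module _ (p : A → Bool) where

    filterᵇ-∷ : ∀ x xs → filterᵇ p (x ∷ xs) ≡ (if p x then x ∷ filterᵇ p xs else filterᵇ p xs)
    filterᵇ-∷ x xs with p x
    ... | true = refl
    ... | false = refl

    filterᵇ-true : ∀ {x} xs → p x ≡ true → filterᵇ p (x ∷ xs) ≡ x ∷ filterᵇ p xs
    filterᵇ-true xs px rewrite px = refl

    filterᵇ-false : ∀ {x} xs → p x ≡ false → filterᵇ p (x ∷ xs) ≡ filterᵇ p xs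
    filterᵇ-false {x} xs px with p x
    ... | false = refl

    filterᵇ-∈-subsets : ∀ xs → filterᵇ p xs ∈ subsets xs
    filterᵇ-∈-subsets [] = here refl
    filterᵇ-∈-subsets (x ∷ xs) with p x
    ... | true = ∈-++⁺ʳ (subsets xs) (∈-map⁺ (x ∷_) (filterᵇ-∈-subsets xs))
    ... | false = ∈-++⁺ˡ (filterᵇ-∈-subsets xs)

    ∈-filterᵇ⁻ : ∀ xs {y} → y ∈ filterᵇ p xs → p y ≡ true
    ∈-filterᵇ⁻ (x ∷ xs) y∈ with p x in px
    ∈-filterᵇ⁻ (x ∷ xs) (here refl) | true = px
    ∈-filterᵇ⁻ (x ∷ xs) (there y∈) | true = ∈-filterᵇ⁻ xs y∈
    ∈-filterᵇ⁻ (x ∷ xs) y∈ | false = ∈-filterᵇ⁻ xs y∈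

    ∈-filterᵇ⁺ : ∀ xs {y} → y ∈ xs → p y ≡ true → y ∈ filterᵇ p xs
    ∈-filterᵇ⁺ (x ∷ xs) (here refl) py rewrite py = here refl
    ∈-filterᵇ⁺ (x ∷ xs) (there y∈) py with p x
    ... | true = there (∈-filterᵇ⁺ xs y∈ py)
    ... | false = ∈-filterᵇ⁺ xs y∈ py

  filterᵇ-cong : ∀ (p q : A → Bool) xs → (∀ {y} → y ∈ xs → p y ≡ q y) → filterᵇ p xs ≡ filterᵇ q xs
  filterᵇ-cong p q [] p≡q = refl
  filterᵇ-cong p q (x ∷ xs) p≡q with p x in px
  ... | true = trans (cong (x ∷_) (filterᵇ-cong p q xs (p≡q ∘ there))) (sym (filterᵇ-true q xs (trans (sym (p≡q (here refl))) px)))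
  ... | false = trans (filterᵇ-cong p q xs (p≡q ∘ there)) (sym (filterᵇ-false q xs (trans (sym (p≡q (here refl))) px)))

  module _ (_≟_ : DecidableEquality A) where

    open DecMembership _≟_ using (_∈?_)

    ⌊∈?∷⌋ : ∀ {y x} J → y ≢ x → ⌊ y ∈? x ∷ J ⌋ ≡ ⌊ y ∈? J ⌋
    ⌊∈?∷⌋ J y≢x = ⌊⌋-⇔ (mk⇔ (λ { (here y≡x) → ⊥-elim (y≢x y≡x) ; (there y∈J) → y∈J }) there) (_ ∈? _) (_ ∈? J)

    filterᵇ-∈-self : ∀ (xs : List A) {J} → Unique xs → J ∈ subsets xs → filterᵇ (λ y → ⌊ y ∈? J ⌋) xs ≡ J
    filterᵇ-∈-self [] _ (here refl) = refl
    filterᵇ-∈-self (x ∷ xs) {J} u J∈ with ∈-++⁻ (subsets xs) J∈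
    ... | inj₁ J∈′ = trans (filterᵇ-false _ xs (⌊⌋-no (x ∈? J) (∉-of-Unique u ∘ subsets-⊆ xs J∈′)))
                           (filterᵇ-∈-self xs (Unique.tail u) J∈′)
    ... | inj₂ J∈′ with J′ , J′∈ , refl ← ∈-map⁻ (x ∷_) J∈′ =
      trans (filterᵇ-true _ xs (⌊⌋-yes (x ∈? x ∷ J′) (here refl)))
            (cong (x ∷_) (trans (filterᵇ-cong _ _ xs (λ y∈xs → ⌊∈?∷⌋ J′ (λ { refl → ∉-of-Unique u y∈xs })))
                                (filterᵇ-∈-self xs (Unique.tail u) J′∈)))

    symDiff : List A → List A → List A → List A
    symDiff xs J C = filterᵇ (λ y → ⌊ y ∈? J ⌋ xor ⌊ y ∈? C ⌋) xs

    private
      true≢false : true ≢ false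
      true≢false ()

      xor-false : ∀ b → b xor false ≡ b
      xor-false true = refl
      xor-false false = refl

      xor-true⇒ : ∀ {P Q : Set} (P? : Dec P) (Q? : Dec Q) → (⌊ P? ⌋ xor ⌊ Q? ⌋) ≡ true → (P × ¬ Q) ⊎ (¬ P × Q)
      xor-true⇒ (yes p) (no ¬q) _ = inj₁ (p , ¬q)
      xor-true⇒ (no ¬p) (yes q) _ = inj₂ (¬p , q)

      xor-true⇐ : ∀ {P Q : Set} (P? : Dec P) (Q? : Dec Q) → (P × ¬ Q) ⊎ (¬ P × Q) → (⌊ P? ⌋ xor ⌊ Q? ⌋) ≡ true
      xor-true⇐ (yes p) (yes q) (inj₁ (_ , ¬q)) = ⊥-elim (¬q q)
      xor-true⇐ (yes p) (yes q) (inj₂ (¬p , _)) = ⊥-elim (¬p p)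
      xor-true⇐ (yes p) (no ¬q) _ = refl
      xor-true⇐ (no ¬p) (yes q) _ = refl
      xor-true⇐ (no ¬p) (no ¬q) (inj₁ (p , _)) = ⊥-elim (¬p p)
      xor-true⇐ (no ¬p) (no ¬q) (inj₂ (_ , q)) = ⊥-elim (¬q q)

    ∈-symDiff⁻ : ∀ xs {J C y} → y ∈ symDiff xs J C → (y ∈ J × y ∉ C) ⊎ (y ∉ J × y ∈ C)
    ∈-symDiff⁻ xs {J} {C} {y} y∈ = xor-true⇒ (y ∈? J) (y ∈? C) (∈-filterᵇ⁻ _ xs y∈)

    ∈-symDiff⁺ : ∀ xs {J C y} → y ∈ xs → (y ∈ J × y ∉ C) ⊎ (y ∉ J × y ∈ C) → y ∈ symDiff xs J C
    ∈-symDiff⁺ xs {J} {C} {y} y∈xs y∈J△C = ∈-filterᵇ⁺ _ xs y∈xs (xor-true⇐ (y ∈? J) (y ∈? C) y∈J△C)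

    symDiff-∈-subsets : ∀ xs J C → symDiff xs J C ∈ subsets xs
    symDiff-∈-subsets xs J C = filterᵇ-∈-subsets _ xs

    ⌊∈?symDiff⌋ : ∀ xs J C {y} → y ∈ xs → ⌊ y ∈? symDiff xs J C ⌋ ≡ ⌊ y ∈? J ⌋ xor ⌊ y ∈? C ⌋
    ⌊∈?symDiff⌋ xs J C {y} y∈xs with ⌊ y ∈? J ⌋ xor ⌊ y ∈? C ⌋ in eq
    ... | true = ⌊⌋-yes (y ∈? symDiff xs J C) (∈-filterᵇ⁺ _ xs y∈xs eq)
    ... | false = ⌊⌋-no (y ∈? symDiff xs J C) (λ y∈ → true≢false (trans (sym (∈-filterᵇ⁻ _ xs y∈)) eq))

    symDiff-involutive : ∀ xs J C → Unique xs → J ∈ subsets xs → symDiff xs (symDiff xs J C) C ≡ J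
    symDiff-involutive xs J C u J∈ =
      trans (filterᵇ-cong _ (λ y → ⌊ y ∈? J ⌋) xs cancel) (filterᵇ-∈-self xs u J∈)
      where
        cancel : ∀ {y} → y ∈ xs → ⌊ y ∈? symDiff xs J C ⌋ xor ⌊ y ∈? C ⌋ ≡ ⌊ y ∈? J ⌋
        cancel {y} y∈xs rewrite ⌊∈?symDiff⌋ xs J C y∈xs
                              | Boolₚ.xor-assoc ⌊ y ∈? J ⌋ ⌊ y ∈? C ⌋ ⌊ y ∈? C ⌋
                              | Boolₚ.xor-same ⌊ y ∈? C ⌋ = xor-false ⌊ y ∈? J ⌋

    sumℤ-symDiff : ∀ xs C → Unique xs → (F : List A → ℤ) →
                   sumℤ (subsets xs) F ≡ sumℤ (subsets xs) (λ J → F (symDiff xs J C))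
    sumℤ-symDiff [] C u F = refl
    sumℤ-symDiff (x ∷ xs) C u F =
      trans (split F) (trans (by-case ⌊ x ∈? C ⌋)
        (sym (trans (split (λ J → F (symDiff (x ∷ xs) J C)))
                    (cong₂ _+_ (sumℤ-cong (subsets xs) (λ J J∈ → cong F (skip-x J∈)))
                               (sumℤ-cong (subsets xs) (λ J J∈ → cong F (take-x J∈)))))))
      where
        S : (List A → ℤ) → ℤ
        S G = sumℤ (subsets xs) G

        Δ : List A → List A
        Δ J = symDiff xs J C

        split : ∀ G → sumℤ (subsets (x ∷ xs)) G ≡ S G + S (λ J → G (x ∷ J))
        split G = trans (sumℤ-++ (subsets xs) _ G) (cong (λ s → S G + s) (sumℤ-map (subsets xs) (x ∷_) G))

        skip-x : ∀ {J} → J ∈ subsets xs → symDiff (x ∷ xs) J C ≡ (if ⌊ x ∈? C ⌋ then x ∷ Δ J else Δ J)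
        skip-x {J} J∈ = trans (filterᵇ-∷ _ x xs)
          (cong (λ b → if b xor ⌊ x ∈? C ⌋ then x ∷ Δ J else Δ J) (⌊⌋-no (x ∈? J) (∉-of-Unique u ∘ subsets-⊆ xs J∈)))

        drop-x : ∀ J → filterᵇ (λ y → ⌊ y ∈? x ∷ J ⌋ xor ⌊ y ∈? C ⌋) xs ≡ Δ J
        drop-x J = filterᵇ-cong _ _ xs (λ y∈xs → cong (_xor _) (⌊∈?∷⌋ J (λ { refl → ∉-of-Unique u y∈xs })))

        take-x : ∀ {J} → J ∈ subsets xs → symDiff (x ∷ xs) (x ∷ J) C ≡ (if not ⌊ x ∈? C ⌋ then x ∷ Δ J else Δ J)
        take-x {J} J∈ = trans (filterᵇ-∷ _ x xs)
          (cong₂ (λ b ys → if b xor ⌊ x ∈? C ⌋ then x ∷ ys else ys) (⌊⌋-yes (x ∈? x ∷ J) (here refl)) (drop-x J))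

        IH = sumℤ-symDiff xs C (Unique.tail u)

        by-case : ∀ c → S F + S (λ J → F (x ∷ J)) ≡
                        S (λ J → F (if c then x ∷ Δ J else Δ J)) + S (λ J → F (if not c then x ∷ Δ J else Δ J))
        by-case true = trans (ℤₚ.+-comm (S F) _) (cong₂ _+_ (IH (λ J → F (x ∷ J))) (IH F))
        by-case false = cong₂ _+_ (IH F) (IH (λ J → F (x ∷ J)))

-- Rows of a biword

module _ {r : ℕ} where

  Ascending : List (Fin r) → Set
  Ascending = AllPairs Fin._≤_

  ascending-↭⇒≡ : ∀ {xs ys} → Ascending xs → Ascending ys → xs ↭ ys → xs ≡ ys
  ascending-↭⇒≡ xs↗ ys↗ xs↭ys =
    Pointwise-≡⇒≡ (↗↭↗⇒≋ O (AllPairs⇒Sorted O xs↗) (AllPairs⇒Sorted O ys↗) (↭⇒↭ₛ xs↭ys))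
    where O = Finₚ.≤-totalOrder r

  sortW-↭ : ∀ (w : List (Fin r)) → sortW w ↭ w
  sortW-↭ = InsertionSortₚ.sort-↭ (Finₚ.≤-decTotalOrder r)

  sortW-ascending : ∀ (w : List (Fin r)) → Ascending (sortW w)
  sortW-ascending w = Sorted⇒AllPairs (Finₚ.≤-totalOrder r) (InsertionSortₚ.sort-↗ (Finₚ.≤-decTotalOrder r) w)

  length-sortW : ∀ (w : List (Fin r)) → length (sortW w) ≡ length w
  length-sortW w = ↭-length (sortW-↭ w)

  row : Biword r → Fin r → List (Fin r)
  row [] x = []
  row ((y , b) ∷ δ) x with y Finₚ.≟ x
  ... | yes _ = b ∷ row δ x
  ... | no _ = row δ x

  row-++ : ∀ (δ δ′ : Biword r) x → row (δ ++ δ′) x ≡ row δ x ++ row δ′ x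
  row-++ [] δ′ x = refl
  row-++ ((y , b) ∷ δ) δ′ x with y Finₚ.≟ x
  ... | yes _ = cong (b ∷_) (row-++ δ δ′ x)
  ... | no _ = row-++ δ δ′ x

  row-∷-≡ : ∀ y {x} b (δ : Biword r) → y ≡ x → row ((y , b) ∷ δ) x ≡ b ∷ row δ x
  row-∷-≡ y {x} b δ y≡x with y Finₚ.≟ x
  ... | yes _ = refl
  ... | no y≢x = ⊥-elim (y≢x y≡x)

  row-∷-≢ : ∀ y {x} b (δ : Biword r) → y ≢ x → row ((y , b) ∷ δ) x ≡ row δ x
  row-∷-≢ y {x} b δ y≢x with y Finₚ.≟ x
  ... | yes y≡x = ⊥-elim (y≢x y≡x)
  ... | no _ = refl

  row-∷-cong : ∀ (b : Biletter r) {δ δ′} x → row δ x ≡ row δ′ x → row (b ∷ δ) x ≡ row (b ∷ δ′) x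
  row-∷-cong (y , c) x eq with y Finₚ.≟ x
  ... | yes _ = cong (c ∷_) eq
  ... | no _ = eq

  row-insertByTop : ∀ (b : Biletter r) δ x → row (insertByTop b δ) x ≡ row (b ∷ δ) x
  row-insertByTop b [] x = refl
  row-insertByTop (y , a) ((y′ , c) ∷ δ) x with y′ Fin.<? y
  ... | no _ = refl
  ... | yes y′<y = commute (y′ Finₚ.≟ x) (y Finₚ.≟ x)
    where
      commute : Dec (y′ ≡ x) → Dec (y ≡ x) → row ((y′ , c) ∷ insertByTop (y , a) δ) x ≡ row ((y , a) ∷ (y′ , c) ∷ δ) x
      commute (yes refl) (yes refl) = ⊥-elim (Finₚ.<-irrefl refl y′<y)
      commute (yes y′≡x) (no y≢x)
        rewrite row-∷-≡ y′ c (insertByTop (y , a) δ) y′≡x | row-∷-≢ y a ((y′ , c) ∷ δ) y≢x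
              | row-∷-≡ y′ c δ y′≡x | row-insertByTop (y , a) δ x | row-∷-≢ y a δ y≢x = refl
      commute (no y′≢x) (yes y≡x)
        rewrite row-∷-≢ y′ c (insertByTop (y , a) δ) y′≢x | row-∷-≡ y a ((y′ , c) ∷ δ) y≡x
              | row-∷-≢ y′ c δ y′≢x | row-insertByTop (y , a) δ x | row-∷-≡ y a δ y≡x = refl
      commute (no y′≢x) (no y≢x)
        rewrite row-∷-≢ y′ c (insertByTop (y , a) δ) y′≢x | row-∷-≢ y a ((y′ , c) ∷ δ) y≢x
              | row-∷-≢ y′ c δ y′≢x | row-insertByTop (y , a) δ x | row-∷-≢ y a δ y≢x = refl

  row-sortByTop : ∀ (α : Biword r) x → row (sortByTop α) x ≡ row α x
  row-sortByTop [] x = refl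
  row-sortByTop (b ∷ α) x = trans (row-insertByTop b (sortByTop α) x) (row-∷-cong b x (row-sortByTop α x))

  row-∷⇒∈ : ∀ (δ : Biword r) {x c l} → row δ x ≡ c ∷ l → (x , c) ∈ δ
  row-∷⇒∈ ((y , b) ∷ δ) {x} eq with y Finₚ.≟ x
  row-∷⇒∈ ((y , b) ∷ δ) refl | yes refl = here refl
  ... | no _ = there (row-∷⇒∈ δ eq)

  ∈⇒row≢[] : ∀ (δ : Biword r) {x c} → (x , c) ∈ δ → row δ x ≢ []
  ∈⇒row≢[] ((y , b) ∷ δ) {x} x,c∈ with y Finₚ.≟ x | x,c∈
  ... | yes _ | _ = λ ()
  ... | no y≢x | here refl = ⊥-elim (y≢x refl)
  ... | no _ | there x,c∈δ = ∈⇒row≢[] δ x,c∈δ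

  insertByTop-↭ : ∀ (b : Biletter r) δ → insertByTop b δ ↭ b ∷ δ
  insertByTop-↭ b [] = ↭-refl
  insertByTop-↭ (y , a) ((y′ , c) ∷ δ) with y′ Fin.<? y
  ... | no _ = ↭-refl
  ... | yes _ = ↭-trans (prep (y′ , c) (insertByTop-↭ (y , a) δ)) (swap (y′ , c) (y , a) ↭-refl)

  sortByTop-↭ : ∀ (α : Biword r) → sortByTop α ↭ α
  sortByTop-↭ [] = ↭-refl
  sortByTop-↭ (b ∷ α) = ↭-trans (insertByTop-↭ b (sortByTop α)) (prep b (sortByTop-↭ α))

  insertByTop-ascending : ∀ (b : Biletter r) δ → Ascending (top δ) → Ascending (top (insertByTop b δ))
  insertByTop-ascending b [] _ = [] ∷ []
  insertByTop-ascending (y , a) ((y′ , c) ∷ δ) (y′≤δ ∷ δ↗) with y′ Fin.<? y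
  ... | no y′≮y = All.tabulate y≤ ∷ y′≤δ ∷ δ↗
    where
      y≤ : ∀ {z} → z ∈ y′ ∷ top δ → y Fin.≤ z
      y≤ (here refl) = ℕₚ.≮⇒≥ y′≮y
      y≤ (there z∈) = Finₚ.≤-trans (ℕₚ.≮⇒≥ y′≮y) (All.lookup y′≤δ z∈)
  ... | yes y′<y =
    All-resp-↭ (↭-sym (map⁺ proj₁ (insertByTop-↭ (y , a) δ))) (ℕₚ.<⇒≤ y′<y ∷ y′≤δ)
      ∷ insertByTop-ascending (y , a) δ δ↗

  sortByTop-ascending : ∀ (α : Biword r) → Ascending (top (sortByTop α))
  sortByTop-ascending [] = []
  sortByTop-ascending (b ∷ α) = insertByTop-ascending b (sortByTop α) (sortByTop-ascending α)

  ≡-by-rows : ∀ (δ δ′ : Biword r) → Ascending (top δ) → Ascending (top δ′) → (∀ x → row δ x ≡ row δ′ x) → δ ≡ δ′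
  ≡-by-rows [] [] _ _ _ = refl
  ≡-by-rows [] ((y , b) ∷ δ′) _ _ rows≡ with () ← trans (rows≡ y) (row-∷-≡ y b δ′ refl)
  ≡-by-rows ((y , b) ∷ δ) [] _ _ rows≡ with () ← trans (sym (rows≡ y)) (row-∷-≡ y b δ refl)
  ≡-by-rows ((y , b) ∷ δ) ((y′ , b′) ∷ δ′) (y≤δ ∷ δ↗) (y′≤δ′ ∷ δ′↗) rows≡ with y′ Finₚ.≟ y
  ... | no y′≢y = ⊥-elim (y′≢y (Finₚ.≤-antisym y′≤y y≤y′))
    where
      y∈δ′ : (y , b) ∈ δ′
      y∈δ′ = row-∷⇒∈ δ′ (trans (sym (row-∷-≢ y′ b′ δ′ y′≢y)) (trans (sym (rows≡ y)) (row-∷-≡ y b δ refl)))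
      y′≤y = All.lookup y′≤δ′ (∈-map⁺ proj₁ y∈δ′)
      y′∈δ : (y′ , b′) ∈ δ
      y′∈δ = row-∷⇒∈ δ (trans (sym (row-∷-≢ y b δ (y′≢y ∘ sym))) (trans (rows≡ y′) (row-∷-≡ y′ b′ δ′ refl)))
      y≤y′ = All.lookup y≤δ (∈-map⁺ proj₁ y′∈δ)
  ... | yes refl = cong₂ _∷_ (cong (y ,_) (Listₚ.∷-injectiveˡ heads)) (≡-by-rows δ δ′ δ↗ δ′↗ tails)
    where
      heads : b ∷ row δ y ≡ b′ ∷ row δ′ y
      heads = trans (sym (row-∷-≡ y b δ refl)) (trans (rows≡ y) (row-∷-≡ y b′ δ′ refl))
      tails : ∀ x → row δ x ≡ row δ′ x
      tails x with y Finₚ.≟ x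
      ... | yes refl = Listₚ.∷-injectiveʳ heads
      ... | no y≢x = trans (sym (row-∷-≢ y b δ y≢x)) (trans (rows≡ x) (row-∷-≢ y b′ δ′ y≢x))

  top-bi : ∀ (a b : List (Fin r)) → length a ≡ length b → top (bi a b) ≡ a
  top-bi [] [] _ = refl
  top-bi (x ∷ a) (y ∷ b) eq = cong (x ∷_) (top-bi a b (ℕₚ.suc-injective eq))

  bottom-bi : ∀ (a b : List (Fin r)) → length a ≡ length b → bottom (bi a b) ≡ b
  bottom-bi [] [] _ = refl
  bottom-bi (x ∷ a) (y ∷ b) eq = cong (y ∷_) (bottom-bi a b (ℕₚ.suc-injective eq))

  bi-top-bottom : ∀ (δ : Biword r) → bi (top δ) (bottom δ) ≡ δ
  bi-top-bottom [] = refl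
  bi-top-bottom ((x , a) ∷ δ) = cong ((x , a) ∷_) (bi-top-bottom δ)

  length-bi : ∀ (a b : List (Fin r)) → length a ≡ length b → length (bi a b) ≡ length a
  length-bi a b eq = trans (sym (Listₚ.length-map proj₁ (bi a b))) (cong length (top-bi a b eq))

  ∈-bi⁻ : ∀ (a b : List (Fin r)) {x c} → (x , c) ∈ bi a b → x ∈ a × c ∈ b
  ∈-bi⁻ (x ∷ a) (y ∷ b) (here refl) = here refl , here refl
  ∈-bi⁻ (x ∷ a) (y ∷ b) (there x,c∈) with ∈-bi⁻ a b x,c∈
  ... | x∈a , c∈b = there x∈a , there c∈b

  ∈-bi⁺ : ∀ (a b : List (Fin r)) {x} → length a ≡ length b → x ∈ a → ∃ λ c → (x , c) ∈ bi a b
  ∈-bi⁺ (x ∷ a) (y ∷ b) _ (here refl) = y , here refl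
  ∈-bi⁺ (x ∷ a) (y ∷ b) eq (there x∈a) with c , x,c∈ ← ∈-bi⁺ a b (ℕₚ.suc-injective eq) x∈a = c , there x,c∈

  row-∉ : ∀ (δ : Biword r) {x} → x ∉ top δ → row δ x ≡ []
  row-∉ [] x∉ = refl
  row-∉ ((y , b) ∷ δ) x∉ = trans (row-∷-≢ y b δ (λ { refl → x∉ (here refl) })) (row-∉ δ (x∉ ∘ there))

  row-single : ∀ (δ : Biword r) {x c} → Unique (top δ) → (x , c) ∈ δ → row δ x ≡ c ∷ []
  row-single ((y , b) ∷ δ) u (here refl) = trans (row-∷-≡ y b δ refl) (cong (b ∷_) (row-∉ δ (∉-of-Unique u)))
  row-single ((y , b) ∷ δ) u (there x,c∈) =
    trans (row-∷-≢ y b δ (λ { refl → ∉-of-Unique u (∈-map⁺ proj₁ x,c∈) })) (row-single δ (Unique.tail u) x,c∈)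

-- The terms α_σ (w̄ over w) of Ferm × Bos

module _ {r : ℕ} where

  bos : List (Fin r) → Biword r
  bos w = bi (sortW w) w

  -- α_σ (w̄ over w) for J = i₁ < ⋯ < i_l and s = σ(i₁) ⋯ σ(i_l).
  config : List (Fin r) → List (Fin r) → List (Fin r) → Biword r
  config J s w = bi s J ++ bos w

  top-bos : ∀ w → top (bos w) ≡ sortW w
  top-bos w = top-bi (sortW w) w (length-sortW w)

  bottom-bos : ∀ w → bottom (bos w) ≡ w
  bottom-bos w = bottom-bi (sortW w) w (length-sortW w)

  bos-ascending : ∀ w → Ascending (top (bos w))
  bos-ascending w = subst Ascending (sym (top-bos w)) (sortW-ascending w)

  top-config : ∀ J s w → s ↭ J → top (config J s w) ≡ s ++ sortW w
  top-config J s w s↭J = trans (Listₚ.map-++ proj₁ (bi s J) (bos w)) (cong₂ _++_ (top-bi s J (↭-length s↭J)) (top-bos w))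

  bottom-config : ∀ J s w → s ↭ J → bottom (config J s w) ≡ J ++ w
  bottom-config J s w s↭J = trans (Listₚ.map-++ proj₂ (bi s J) (bos w)) (cong₂ _++_ (bottom-bi s J (↭-length s↭J)) (bottom-bos w))

  module _ {J s : List (Fin r)} (uJ : Unique J) (s↭J : s ↭ J) where

    Unique-top-bi : Unique (top (bi s J))
    Unique-top-bi = subst Unique (sym (top-bi s J (↭-length s↭J))) (Unique-resp-↭ (↭-sym s↭J) uJ)

    ∈J⇒∈bi : ∀ {x} → x ∈ J → ∃ λ c → (x , c) ∈ bi s J
    ∈J⇒∈bi x∈J = ∈-bi⁺ s J (↭-length s↭J) (∈-resp-↭ (↭-sym s↭J) x∈J)

    row-config-∈ : ∀ w {x c} → (x , c) ∈ bi s J → row (config J s w) x ≡ c ∷ row (bos w) x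
    row-config-∈ w {x} x,c∈ = trans (row-++ (bi s J) (bos w) x) (cong (_++ row (bos w) x) (row-single (bi s J) Unique-top-bi x,c∈))

    row-config-∉ : ∀ w {x} → x ∉ J → row (config J s w) x ≡ row (bos w) x
    row-config-∉ w {x} x∉J = trans (row-++ (bi s J) (bos w) x)
      (cong (_++ row (bos w) x) (row-∉ (bi s J) (λ x∈ → x∉J (∈-resp-↭ s↭J (subst (x ∈_) (top-bi s J (↭-length s↭J)) x∈)))))

  bi-≡ : ∀ (J s s′ : List (Fin r)) → Unique J → length s ≡ length J → length s′ ≡ length J →
         (∀ {p} → p ∈ bi s J → p ∈ bi s′ J) → s ≡ s′
  bi-≡ [] [] [] _ _ _ _ = refl
  bi-≡ (j ∷ J) (a ∷ s) (a′ ∷ s′) u eq eq′ bi⊆ =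
    cong₂ _∷_ a≡a′ (bi-≡ J s s′ (Unique.tail u) (ℕₚ.suc-injective eq) (ℕₚ.suc-injective eq′) bi⊆′)
    where
      a≡a′ : a ≡ a′
      a≡a′ with bi⊆ (here refl)
      ... | here refl = refl
      ... | there a,j∈ = ⊥-elim (∉-of-Unique u (proj₂ (∈-bi⁻ s′ J a,j∈)))
      bi⊆′ : ∀ {p} → p ∈ bi s J → p ∈ bi s′ J
      bi⊆′ p∈ with bi⊆ (there p∈)
      ... | here refl = ⊥-elim (∉-of-Unique u (proj₂ (∈-bi⁻ s J p∈)))
      ... | there p∈′ = p∈′

  config-injective : ∀ {J s s′ w w′ : List (Fin r)} → Unique J → s ↭ J → s′ ↭ J →
                     sortByTop (config J s w) ≡ sortByTop (config J s′ w′) → s ≡ s′ × w ≡ w′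
  config-injective {J} {s} {s′} {w} {w′} uJ s↭J s′↭J eq = s≡s′ , w≡w′
    where
      rows≡ : ∀ x → row (config J s w) x ≡ row (config J s′ w′) x
      rows≡ x = trans (sym (row-sortByTop (config J s w) x)) (trans (cong (λ β → row β x) eq) (row-sortByTop (config J s′ w′) x))

      heads : ∀ {x c c′} → (x , c) ∈ bi s J → (x , c′) ∈ bi s′ J → c ∷ row (bos w) x ≡ c′ ∷ row (bos w′) x
      heads {x} x,c∈ x,c′∈ = trans (sym (row-config-∈ uJ s↭J w x,c∈)) (trans (rows≡ x) (row-config-∈ uJ s′↭J w′ x,c′∈))

      bos-rows : ∀ x → row (bos w) x ≡ row (bos w′) x
      bos-rows x with Any.any? (x Finₚ.≟_) J
      ... | yes x∈J = Listₚ.∷-injectiveʳ (heads (proj₂ (∈J⇒∈bi uJ s↭J x∈J)) (proj₂ (∈J⇒∈bi uJ s′↭J x∈J)))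
      ... | no x∉J = trans (sym (row-config-∉ uJ s↭J w x∉J)) (trans (rows≡ x) (row-config-∉ uJ s′↭J w′ x∉J))

      w≡w′ : w ≡ w′
      w≡w′ = trans (sym (bottom-bos w)) (trans (cong bottom (≡-by-rows (bos w) (bos w′) (bos-ascending w) (bos-ascending w′) bos-rows))
                                               (bottom-bos w′))

      bi⊆ : ∀ {p} → p ∈ bi s J → p ∈ bi s′ J
      bi⊆ {x , c} x,c∈ with ∈J⇒∈bi uJ s′↭J (∈-resp-↭ s↭J (proj₁ (∈-bi⁻ s J x,c∈)))
      ... | c′ , x,c′∈ rewrite Listₚ.∷-injectiveˡ (heads x,c∈ x,c′∈) = x,c′∈

      s≡s′ : s ≡ s′
      s≡s′ = bi-≡ J s s′ uJ (↭-length s↭J) (↭-length s′↭J) bi⊆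

  -- The default x is only reached on an empty row, where lead is never used.
  lead : Biword r → Fin r → Fin r
  lead β x = fromMaybe x (head (row β x))

  row-lead : ∀ (β : Biword r) x → row β x ≢ [] → row β x ≡ lead β x ∷ drop 1 (row β x)
  row-lead β x row≢[] with row β x
  ... | [] = ⊥-elim (row≢[] refl)
  ... | c ∷ l = refl

  lead-∈ : ∀ (β : Biword r) x → row β x ≢ [] → (x , lead β x) ∈ β
  lead-∈ β x row≢[] = row-∷⇒∈ β (row-lead β x row≢[])

  Balanced : Biword r → Set
  Balanced β = top β ↭ bottom β

  Permutes : (Fin r → Fin r) → List (Fin r) → Set
  Permutes f Y = map f Y ↭ Y

  Permutes-∈ : ∀ {f Y y} → Permutes f Y → y ∈ Y → f y ∈ Y
  Permutes-∈ {f} f↺Y y∈Y = ∈-resp-↭ f↺Y (∈-map⁺ f y∈Y)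

  record Admissible (β : Biword r) (J : List (Fin r)) : Set where
    field
      rows-nonempty : ∀ {x} → x ∈ J → row β x ≢ []
      lead-permutes : Permutes (lead β) J

  map-≡-bi : ∀ (g : Fin r → Fin r) (s J : List (Fin r)) → length s ≡ length J →
             (∀ {x c} → (x , c) ∈ bi s J → g x ≡ c) → map g s ≡ J
  map-≡-bi g [] [] _ _ = refl
  map-≡-bi g (x ∷ s) (c ∷ J) eq g≡ = cong₂ _∷_ (g≡ (here refl)) (map-≡-bi g s J (ℕₚ.suc-injective eq) (g≡ ∘ there))

  config-balanced : ∀ J s w → s ↭ J → Balanced (sortByTop (config J s w))
  config-balanced J s w s↭J = begin
    top (sortByTop (config J s w))     ↭⟨ map⁺ proj₁ (sortByTop-↭ (config J s w)) ⟩
    top (config J s w)                 ≡⟨ top-config J s w s↭J ⟩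
    s ++ sortW w                       ↭⟨ ++⁺ s↭J (sortW-↭ w) ⟩
    J ++ w                             ≡⟨ bottom-config J s w s↭J ⟨
    bottom (config J s w)              ↭⟨ map⁺ proj₂ (sortByTop-↭ (config J s w)) ⟨
    bottom (sortByTop (config J s w))  ∎
    where open PermutationReasoning

  module _ {J s : List (Fin r)} (uJ : Unique J) (s↭J : s ↭ J) (w : List (Fin r)) where

    private
      β = sortByTop (config J s w)

      row-β : ∀ {x c} → (x , c) ∈ bi s J → row β x ≡ c ∷ row (bos w) x
      row-β {x} x,c∈ = trans (row-sortByTop (config J s w) x) (row-config-∈ uJ s↭J w x,c∈)

    map-lead-config : map (lead β) s ≡ J
    map-lead-config = map-≡-bi (lead β) s J (↭-length s↭J) (λ {x} x,c∈ → cong (fromMaybe x ∘ head) (row-β x,c∈))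

    config-admissible : Admissible β J
    config-admissible = record
      { rows-nonempty = λ x∈J → subst (_≢ []) (sym (row-β (proj₂ (∈J⇒∈bi uJ s↭J x∈J)))) (λ ())
      ; lead-permutes = subst (map (lead β) J ↭_) map-lead-config (map⁺ (lead β) (↭-sym s↭J))
      }

  bos-of-ascending : ∀ (δ : Biword r) → Ascending (top δ) → Balanced δ → bos (bottom δ) ≡ δ
  bos-of-ascending δ δ↗ δ-balanced = trans (cong (λ t → bi t (bottom δ)) sortW≡top) (bi-top-bottom δ)
    where
      sortW≡top : sortW (bottom δ) ≡ top δ
      sortW≡top = ascending-↭⇒≡ (sortW-ascending (bottom δ)) δ↗ (↭-trans (sortW-↭ (bottom δ)) (↭-sym δ-balanced))

  graph : (Fin r → Fin r) → List (Fin r) → Biword r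
  graph f = map (λ x → (x , f x))

  top-graph : ∀ f J → top (graph f J) ≡ J
  top-graph f [] = refl
  top-graph f (x ∷ J) = cong (x ∷_) (top-graph f J)

  bottom-graph : ∀ f J → bottom (graph f J) ≡ map f J
  bottom-graph f [] = refl
  bottom-graph f (x ∷ J) = cong (f x ∷_) (bottom-graph f J)

  insertOn : (Fin r → Fin r) → Fin r → List (Fin r) → List (Fin r)
  insertOn f x [] = x ∷ []
  insertOn f x (y ∷ ys) = if does (f x Finₚ.≤? f y) then x ∷ y ∷ ys else y ∷ insertOn f x ys

  sortOn : (Fin r → Fin r) → List (Fin r) → List (Fin r)
  sortOn f [] = []
  sortOn f (x ∷ xs) = insertOn f x (sortOn f xs)

  map-insertOn : ∀ f x ys → map f (insertOn f x ys) ≡ InsertionSort.insert (Finₚ.≤-decTotalOrder r) (f x) (map f ys)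
  map-insertOn f x [] = refl
  map-insertOn f x (y ∷ ys) with does (f x Finₚ.≤? f y)
  ... | true = refl
  ... | false = cong (f y ∷_) (map-insertOn f x ys)

  map-sortOn : ∀ f xs → map f (sortOn f xs) ≡ sortW (map f xs)
  map-sortOn f [] = refl
  map-sortOn f (x ∷ xs) =
    trans (map-insertOn f x (sortOn f xs)) (cong (InsertionSort.insert (Finₚ.≤-decTotalOrder r) (f x)) (map-sortOn f xs))

  insertOn-↭ : ∀ f x ys → insertOn f x ys ↭ x ∷ ys
  insertOn-↭ f x [] = ↭-refl
  insertOn-↭ f x (y ∷ ys) with does (f x Finₚ.≤? f y)
  ... | true = ↭-refl
  ... | false = ↭-trans (prep y (insertOn-↭ f x ys)) (swap y x ↭-refl)

  sortOn-↭ : ∀ f xs → sortOn f xs ↭ xs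
  sortOn-↭ f [] = ↭-refl
  sortOn-↭ f (x ∷ xs) = ↭-trans (insertOn-↭ f x (sortOn f xs)) (prep x (sortOn-↭ f xs))

  removeFirst : Fin r → Biword r → Biword r
  removeFirst x [] = []
  removeFirst x ((y , b) ∷ δ) with y Finₚ.≟ x
  ... | yes _ = δ
  ... | no _ = (y , b) ∷ removeFirst x δ

  row-removeFirst-self : ∀ x (δ : Biword r) → row (removeFirst x δ) x ≡ drop 1 (row δ x)
  row-removeFirst-self x [] = refl
  row-removeFirst-self x ((y , b) ∷ δ) with y Finₚ.≟ x
  ... | yes _ = refl
  ... | no y≢x = trans (row-∷-≢ y b (removeFirst x δ) y≢x) (row-removeFirst-self x δ)

  row-removeFirst-other : ∀ x {z} (δ : Biword r) → z ≢ x → row (removeFirst x δ) z ≡ row δ z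
  row-removeFirst-other x [] z≢x = refl
  row-removeFirst-other x ((y , b) ∷ δ) z≢x with y Finₚ.≟ x
  ... | yes refl = sym (row-∷-≢ y b δ (z≢x ∘ sym))
  ... | no _ = row-∷-cong (y , b) _ (row-removeFirst-other x δ z≢x)

  removeFirst-⊆ : ∀ x (δ : Biword r) {p} → p ∈ removeFirst x δ → p ∈ δ
  removeFirst-⊆ x ((y , b) ∷ δ) p∈ with y Finₚ.≟ x
  ... | yes _ = there p∈
  removeFirst-⊆ x ((y , b) ∷ δ) (here refl) | no _ = here refl
  removeFirst-⊆ x ((y , b) ∷ δ) (there p∈) | no _ = there (removeFirst-⊆ x δ p∈)

  removeFirst-ascending : ∀ x (δ : Biword r) → Ascending (top δ) → Ascending (top (removeFirst x δ))
  removeFirst-ascending x [] δ↗ = δ↗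
  removeFirst-ascending x ((y , b) ∷ δ) (y≤δ ∷ δ↗) with y Finₚ.≟ x
  ... | yes _ = δ↗
  ... | no _ = All.tabulate y≤ ∷ removeFirst-ascending x δ δ↗
    where
      y≤ : ∀ {z} → z ∈ top (removeFirst x δ) → y Fin.≤ z
      y≤ z∈ with p , p∈ , refl ← ∈-map⁻ proj₁ z∈ = All.lookup y≤δ (∈-map⁺ proj₁ (removeFirst-⊆ x δ p∈))

  removeFirst-↭ : ∀ x (δ : Biword r) {c l} → row δ x ≡ c ∷ l → δ ↭ (x , c) ∷ removeFirst x δ
  removeFirst-↭ x ((y , b) ∷ δ) row≡ with y Finₚ.≟ x
  removeFirst-↭ x ((y , b) ∷ δ) refl | yes refl = ↭-refl
  ... | no _ = ↭-trans (prep (y , b) (removeFirst-↭ x δ row≡)) (swap (y , b) _ ↭-refl)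

  removeFirsts : List (Fin r) → Biword r → Biword r
  removeFirsts [] δ = δ
  removeFirsts (x ∷ J) δ = removeFirst x (removeFirsts J δ)

  row-removeFirsts-∉ : ∀ J (δ : Biword r) {z} → z ∉ J → row (removeFirsts J δ) z ≡ row δ z
  row-removeFirsts-∉ [] δ z∉ = refl
  row-removeFirsts-∉ (x ∷ J) δ z∉ =
    trans (row-removeFirst-other x (removeFirsts J δ) (z∉ ∘ here)) (row-removeFirsts-∉ J δ (z∉ ∘ there))

  row-removeFirsts-∈ : ∀ J (δ : Biword r) → Unique J → ∀ {z} → z ∈ J → row (removeFirsts J δ) z ≡ drop 1 (row δ z)
  row-removeFirsts-∈ (x ∷ J) δ u (here refl) =
    trans (row-removeFirst-self x (removeFirsts J δ)) (cong (drop 1) (row-removeFirsts-∉ J δ (∉-of-Unique u)))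
  row-removeFirsts-∈ (x ∷ J) δ u (there z∈) =
    trans (row-removeFirst-other x (removeFirsts J δ) (λ { refl → ∉-of-Unique u z∈ })) (row-removeFirsts-∈ J δ (Unique.tail u) z∈)

  removeFirsts-ascending : ∀ J (δ : Biword r) → Ascending (top δ) → Ascending (top (removeFirsts J δ))
  removeFirsts-ascending [] δ δ↗ = δ↗
  removeFirsts-ascending (x ∷ J) δ δ↗ = removeFirst-ascending x (removeFirsts J δ) (removeFirsts-ascending J δ δ↗)

  removeFirsts-↭ : ∀ J (β : Biword r) → Unique J → (∀ {x} → x ∈ J → row β x ≢ []) →
                   β ↭ graph (lead β) J ++ removeFirsts J β
  removeFirsts-↭ [] β u nonempty = ↭-refl
  removeFirsts-↭ (x ∷ J) β u nonempty = begin
    β                                                                ↭⟨ removeFirsts-↭ J β (Unique.tail u) (nonempty ∘ there) ⟩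
    graph (lead β) J ++ removeFirsts J β
      ↭⟨ ++⁺ˡ (graph (lead β) J) (removeFirst-↭ x (removeFirsts J β) row≡) ⟩
    graph (lead β) J ++ (x , lead β x) ∷ removeFirst x (removeFirsts J β) ↭⟨ shift (x , lead β x) (graph (lead β) J) _ ⟩
    graph (lead β) (x ∷ J) ++ removeFirsts (x ∷ J) β                 ∎
    where
      open PermutationReasoning
      row≡ : row (removeFirsts J β) x ≡ lead β x ∷ drop 1 (row β x)
      row≡ = trans (row-removeFirsts-∉ J β (∉-of-Unique u)) (row-lead β x (nonempty (here refl)))

  removeFirsts-balanced : ∀ J (β : Biword r) → Unique J → (∀ {x} → x ∈ J → row β x ≢ []) →
                          Balanced β → Permutes (lead β) J → Balanced (removeFirsts J β)
  removeFirsts-balanced J β uJ nonempty β-balanced lead↺J =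
    ++-cancelˡ-↭ J (↭-trans (↭-sym top-split) (↭-trans β-balanced (↭-trans bottom-split (++⁺ʳ (bottom β⁻) lead↺J))))
    where
      β⁻ = removeFirsts J β
      split = removeFirsts-↭ J β uJ nonempty
      top-split : top β ↭ J ++ top β⁻
      top-split = subst (top β ↭_) (trans (Listₚ.map-++ proj₁ (graph (lead β) J) β⁻) (cong (_++ top β⁻) (top-graph (lead β) J)))
                        (map⁺ proj₁ split)
      bottom-split : bottom β ↭ map (lead β) J ++ bottom β⁻
      bottom-split = subst (bottom β ↭_)
                           (trans (Listₚ.map-++ proj₂ (graph (lead β) J) β⁻) (cong (_++ bottom β⁻) (bottom-graph (lead β) J)))
                           (map⁺ proj₂ split)

  ∈-bi-map⁻ : ∀ (g : Fin r → Fin r) s {x c} → (x , c) ∈ bi s (map g s) → c ≡ g x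
  ∈-bi-map⁻ g (y ∷ s) (here refl) = refl
  ∈-bi-map⁻ g (y ∷ s) (there x,c∈) = ∈-bi-map⁻ g s x,c∈

  config-exists : ∀ (β : Biword r) J → AllPairs Fin._<_ J → Ascending (top β) → Balanced β → Admissible β J →
                  ∃ λ s → ∃ λ w → s ↭ J × sortByTop (config J s w) ≡ β × length J ℕ.+ length w ≡ length β
  config-exists β J J↗ β↗ β-balanced adm = s , w , s↭J , config≡β , length≡
    where
      open Admissible adm
      f = lead β
      uJ : Unique J
      uJ = AllPairs.map Finₚ.<⇒≢ J↗
      s = sortOn f J
      s↭J = sortOn-↭ f J
      map-f-s : map f s ≡ J
      map-f-s = trans (map-sortOn f J)
        (ascending-↭⇒≡ (sortW-ascending (map f J)) (AllPairs.map ℕₚ.<⇒≤ J↗) (↭-trans (sortW-↭ (map f J)) lead-permutes))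
      β⁻ = removeFirsts J β
      w = bottom β⁻
      β⁻-balanced : Balanced β⁻
      β⁻-balanced = removeFirsts-balanced J β uJ rows-nonempty β-balanced lead-permutes
      bos≡β⁻ : bos w ≡ β⁻
      bos≡β⁻ = bos-of-ascending β⁻ (removeFirsts-ascending J β β↗) β⁻-balanced
      rows≡ : ∀ x → row (config J s w) x ≡ row β x
      rows≡ x with Any.any? (x Finₚ.≟_) J
      ... | yes x∈J with c , x,c∈ ← ∈J⇒∈bi uJ s↭J x∈J = begin
        row (config J s w) x            ≡⟨ row-config-∈ uJ s↭J w x,c∈ ⟩
        c ∷ row (bos w) x
          ≡⟨ cong₂ (λ c′ δ → c′ ∷ row δ x) (∈-bi-map⁻ f s (subst (λ K → (x , c) ∈ bi s K) (sym map-f-s) x,c∈)) bos≡β⁻ ⟩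
        f x ∷ row β⁻ x                  ≡⟨ cong (f x ∷_) (row-removeFirsts-∈ J β uJ x∈J) ⟩
        f x ∷ drop 1 (row β x)          ≡⟨ row-lead β x (rows-nonempty x∈J) ⟨
        row β x                         ∎
        where open ≡-Reasoning
      ... | no x∉J = trans (row-config-∉ uJ s↭J w x∉J) (trans (cong (λ δ → row δ x) bos≡β⁻) (row-removeFirsts-∉ J β x∉J))
      config≡β : sortByTop (config J s w) ≡ β
      config≡β = ≡-by-rows (sortByTop (config J s w)) β (sortByTop-ascending (config J s w)) β↗
                           (λ x → trans (row-sortByTop (config J s w) x) (rows≡ x))
      length≡ : length J ℕ.+ length w ≡ length β
      length≡ = sym (trans (↭-length (removeFirsts-↭ J β uJ rows-nonempty)) (trans (Listₚ.length-++ (graph f J))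
                  (cong₂ ℕ._+_ (Listₚ.length-map _ J) (sym (Listₚ.length-map proj₂ β⁻)))))

-- Inversions and the sign of a permutation

times-minus-one : ∀ s → s * -1ℤ ≡ - s
times-minus-one s = trans (ℤₚ.*-comm s -1ℤ) (ℤₚ.-1*i≡-i s)

regroup-signs : ∀ P a₀ a₁ m x y → a₁ * a₁ ≡ 1ℤ → x * y ≡ -1ℤ →
                (P * (a₁ * m)) * ((x * a₀) * (a₁ * y)) ≡ - (P * (a₀ * m))
regroup-signs P a₀ a₁ m x y a₁² xy = begin
  (P * (a₁ * m)) * ((x * a₀) * (a₁ * y))  ≡⟨ commute P a₀ a₁ m x y ⟩
  (P * (a₀ * m)) * (a₁ * a₁) * (x * y)    ≡⟨ cong₂ (λ s t → (P * (a₀ * m)) * s * t) a₁² xy ⟩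
  (P * (a₀ * m)) * 1ℤ * -1ℤ               ≡⟨ times-minus-one (P * (a₀ * m) * 1ℤ) ⟩
  - (P * (a₀ * m) * 1ℤ)                   ≡⟨ cong -_ (ℤₚ.*-identityʳ (P * (a₀ * m))) ⟩
  - (P * (a₀ * m))                        ∎
  where
    open ≡-Reasoning
    commute : ∀ P a₀ a₁ m x y → (P * (a₁ * m)) * ((x * a₀) * (a₁ * y)) ≡ (P * (a₀ * m)) * (a₁ * a₁) * (x * y)
    commute = solve-∀

sign-+ : ∀ m n → sign (m ℕ.+ n) ≡ sign m * sign n
sign-+ zero n = sym (ℤₚ.*-identityˡ (sign n))
sign-+ (suc m) n rewrite sign-+ m n = ℤₚ.neg-distribˡ-* (sign m) (sign n)

sign-*-self : ∀ n → sign n * sign n ≡ 1ℤ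
sign-*-self zero = refl
sign-*-self (suc n) = trans (neg-*-neg (sign n)) (sign-*-self n)
  where neg-*-neg : ∀ a → (- a) * (- a) ≡ a * a
        neg-*-neg = solve-∀

sign-sumℕ : ∀ {A : Set} (xs : List A) (g g₁ g₂ : A → ℕ) → (∀ {x} → x ∈ xs → sign (g x) ≡ sign (g₁ x) * sign (g₂ x)) →
            sign (sumℕ xs g) ≡ sign (sumℕ xs g₁) * sign (sumℕ xs g₂)
sign-sumℕ [] g g₁ g₂ _ = refl
sign-sumℕ (x ∷ xs) g g₁ g₂ sign≡
  rewrite sign-+ (g x) (sumℕ xs g) | sign-+ (g₁ x) (sumℕ xs g₁) | sign-+ (g₂ x) (sumℕ xs g₂)
        | sign≡ (here refl) | sign-sumℕ xs g g₁ g₂ (sign≡ ∘ there) =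
  interchange (sign (g₁ x)) (sign (g₂ x)) (sign (sumℕ xs g₁)) (sign (sumℕ xs g₂))
  where interchange : ∀ a b c d → (a * b) * (c * d) ≡ (a * c) * (b * d)
        interchange = solve-∀

countB-sumℕ : ∀ {A : Set} (p : A → Bool) xs → countB p xs ≡ sumℕ xs (𝟙 ∘ p)
countB-sumℕ p [] = refl
countB-sumℕ p (y ∷ xs) = trans (countB-∷ p y xs) (cong (𝟙 (p y) ℕ.+_) (countB-sumℕ p xs))

module _ {r : ℕ} where

  inversion : Biletter r → Biletter r → ℕ
  inversion (a , A) (b , B) = ⟦ a < b ⟧ ℕ.* ⟦ B < A ⟧

  crossings : Biword r → Biword r → ℕ
  crossings E₁ E₂ = sumℕ E₁ (λ e → sumℕ E₂ (inversion e))

  inversions : Biword r → ℕ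
  inversions E = crossings E E

  inversion-self : ∀ (e : Biletter r) → inversion e e ≡ 0
  inversion-self (a , A) rewrite ⟦<⟧-no (Finₚ.<-irrefl {x = a} refl) = refl

  inversions-↭ : ∀ {E E′ : Biword r} → E ↭ E′ → inversions E ≡ inversions E′
  inversions-↭ {E} {E′} E↭E′ =
    trans (sumℕ-cong E (λ e _ → sumℕ-↭ (inversion e) E↭E′)) (sumℕ-↭ (λ e → sumℕ E′ (inversion e)) E↭E′)

  inversions-++ : ∀ (E₁ E₂ : Biword r) →
                  inversions (E₁ ++ E₂) ≡ (inversions E₁ ℕ.+ inversions E₂) ℕ.+ (crossings E₁ E₂ ℕ.+ crossings E₂ E₁)
  inversions-++ E₁ E₂ = begin
    inversions (E₁ ++ E₂)
      ≡⟨ sumℕ-++ E₁ E₂ _ ⟩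
    sumℕ E₁ (λ e → sumℕ (E₁ ++ E₂) (inversion e)) ℕ.+ sumℕ E₂ (λ e → sumℕ (E₁ ++ E₂) (inversion e))
      ≡⟨ cong₂ ℕ._+_ (trans (sumℕ-cong E₁ (λ e _ → sumℕ-++ E₁ E₂ (inversion e))) (sumℕ-+ E₁ _ _))
                     (trans (sumℕ-cong E₂ (λ e _ → sumℕ-++ E₁ E₂ (inversion e))) (sumℕ-+ E₂ _ _)) ⟩
    (inversions E₁ ℕ.+ crossings E₁ E₂) ℕ.+ (crossings E₂ E₁ ℕ.+ inversions E₂)
      ≡⟨ regroup (inversions E₁) (crossings E₁ E₂) (crossings E₂ E₁) (inversions E₂) ⟩
    (inversions E₁ ℕ.+ inversions E₂) ℕ.+ (crossings E₁ E₂ ℕ.+ crossings E₂ E₁) ∎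
    where
      open ≡-Reasoning
      regroup : ∀ a b c d → (a ℕ.+ b) ℕ.+ (c ℕ.+ d) ≡ (a ℕ.+ d) ℕ.+ (b ℕ.+ c)
      regroup = solveℕ-∀

  ⟦<⟧-≢ : ∀ {a b : Fin r} → a ≢ b → (⟦ a < b ⟧ ≡ 1 × ⟦ b < a ⟧ ≡ 0) ⊎ (⟦ a < b ⟧ ≡ 0 × ⟦ b < a ⟧ ≡ 1)
  ⟦<⟧-≢ a≢b with Finₚ.<-cmp _ _
  ... | tri< a<b _ b≮a = inj₁ (⟦<⟧-yes a<b , ⟦<⟧-no b≮a)
  ... | tri≈ _ a≡b _ = ⊥-elim (a≢b a≡b)
  ... | tri> a≮b _ b<a = inj₂ (⟦<⟧-no a≮b , ⟦<⟧-yes b<a)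

  sign-inversion-pair : ∀ {a A b B : Fin r} → a ≢ b → A ≢ B →
    sign (inversion (a , A) (b , B) ℕ.+ inversion (b , B) (a , A)) ≡ sign ⟦ b < a ⟧ * sign ⟦ B < A ⟧
  sign-inversion-pair {a} {A} {b} {B} a≢b A≢B =
    trans (cong (λ n → sign (⟦ a < b ⟧ ℕ.* ⟦ B < A ⟧ ℕ.+ n)) (ℕₚ.*-comm ⟦ b < a ⟧ ⟦ A < B ⟧))
          (by-values (⟦<⟧-≢ a≢b) (⟦<⟧-≢ A≢B))
    where
      by-values : ∀ {x y u v} → (x ≡ 1 × y ≡ 0) ⊎ (x ≡ 0 × y ≡ 1) → (u ≡ 1 × v ≡ 0) ⊎ (u ≡ 0 × v ≡ 1) →
                  sign (x ℕ.* v ℕ.+ u ℕ.* y) ≡ sign y * sign v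
      by-values (inj₁ (refl , refl)) (inj₁ (refl , refl)) = refl
      by-values (inj₁ (refl , refl)) (inj₂ (refl , refl)) = refl
      by-values (inj₂ (refl , refl)) (inj₁ (refl , refl)) = refl
      by-values (inj₂ (refl , refl)) (inj₂ (refl , refl)) = refl

  sign-crossings : ∀ (E₁ E₂ : Biword r) →
    (∀ {e e′} → e ∈ E₁ → e′ ∈ E₂ → proj₁ e ≢ proj₁ e′ × proj₂ e ≢ proj₂ e′) →
    sign (crossings E₁ E₂ ℕ.+ crossings E₂ E₁) ≡
      sign (sumℕ E₁ (λ e → sumℕ E₂ (λ e′ → ⟦ proj₁ e′ < proj₁ e ⟧)))
      * sign (sumℕ E₁ (λ e → sumℕ E₂ (λ e′ → ⟦ proj₂ e′ < proj₂ e ⟧)))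
  sign-crossings E₁ E₂ apart =
    trans (cong sign symmetrised)
          (sign-sumℕ E₁ _ _ _ (λ e∈ → sign-sumℕ E₂ _ _ _ (λ e′∈ → pair (apart e∈ e′∈))))
    where
      symmetrised : crossings E₁ E₂ ℕ.+ crossings E₂ E₁
                    ≡ sumℕ E₁ (λ e → sumℕ E₂ (λ e′ → inversion e e′ ℕ.+ inversion e′ e))
      symmetrised = trans (cong (crossings E₁ E₂ ℕ.+_) (sumℕ-comm E₂ E₁ inversion))
                          (trans (sym (sumℕ-+ E₁ _ _)) (sumℕ-cong E₁ (λ e _ → sym (sumℕ-+ E₂ _ _))))
      pair : ∀ {e e′ : Biletter r} → proj₁ e ≢ proj₁ e′ × proj₂ e ≢ proj₂ e′ →
             sign (inversion e e′ ℕ.+ inversion e′ e) ≡ sign ⟦ proj₁ e′ < proj₁ e ⟧ * sign ⟦ proj₂ e′ < proj₂ e ⟧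
      pair {a , A} {b , B} (a≢b , A≢B) = sign-inversion-pair a≢b A≢B

  -- For f permuting X this is (-1)^|X| sgn (f restricted to X) = (-1)^(number of cycles).
  cycleSign : (Fin r → Fin r) → List (Fin r) → ℤ
  cycleSign f X = sign (length X) * sign (inversions (graph f X))

  -- As f permutes both Y and C, counting crossings by bottom letters gives the same number
  -- as counting them by top letters, so the cross terms contribute an even number.
  sign-crossings-graph : ∀ {f Y C} → Permutes f Y → Permutes f C → (∀ {y} → y ∈ Y → y ∉ C) →
    sign (crossings (graph f Y) (graph f C) ℕ.+ crossings (graph f C) (graph f Y)) ≡ 1ℤ
  sign-crossings-graph {f} {Y} {C} f↺Y f↺C Y∩C=∅ =
    trans (sign-crossings (graph f Y) (graph f C) apart) (trans (cong (λ n → sign tops * sign n) bottoms≡tops) (sign-*-self tops))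
    where
      apart : ∀ {e e′} → e ∈ graph f Y → e′ ∈ graph f C → proj₁ e ≢ proj₁ e′ × proj₂ e ≢ proj₂ e′
      apart e∈ e′∈ with y , y∈Y , refl ← ∈-map⁻ _ e∈ | c , c∈C , refl ← ∈-map⁻ _ e′∈ =
        (λ { refl → Y∩C=∅ y∈Y c∈C }) ,
        (λ fy≡fc → Y∩C=∅ (Permutes-∈ f↺Y y∈Y) (subst (_∈ C) (sym fy≡fc) (Permutes-∈ f↺C c∈C)))
      tops = sumℕ (graph f Y) (λ e → sumℕ (graph f C) (λ e′ → ⟦ proj₁ e′ < proj₁ e ⟧))
      bottoms = sumℕ (graph f Y) (λ e → sumℕ (graph f C) (λ e′ → ⟦ proj₂ e′ < proj₂ e ⟧))
      bottoms≡tops : bottoms ≡ tops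
      bottoms≡tops = begin
        bottoms
          ≡⟨ trans (sumℕ-map Y _ _) (sumℕ-cong Y (λ y _ → sumℕ-map C _ _)) ⟩
        sumℕ Y (λ y → sumℕ C (λ c → ⟦ f c < f y ⟧))
          ≡⟨ trans (sumℕ-map Y f _) (sumℕ-cong Y (λ y _ → sumℕ-map C f (λ c → ⟦ c < f y ⟧))) ⟨
        sumℕ (map f Y) (λ y → sumℕ (map f C) (λ c → ⟦ c < y ⟧))
          ≡⟨ trans (sumℕ-↭ (λ y → sumℕ (map f C) (λ c → ⟦ c < y ⟧)) f↺Y)
                   (sumℕ-cong Y (λ y _ → sumℕ-↭ (λ c → ⟦ c < y ⟧) f↺C)) ⟩
        sumℕ Y (λ y → sumℕ C (λ c → ⟦ c < y ⟧))
          ≡⟨ trans (sumℕ-map Y _ _) (sumℕ-cong Y (λ y _ → sumℕ-map C _ _)) ⟨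
        tops ∎
        where open ≡-Reasoning

  cycleSign-++ : ∀ {f X Y C} → X ↭ Y ++ C → Permutes f Y → Permutes f C → (∀ {y} → y ∈ Y → y ∉ C) →
                 cycleSign f X ≡ cycleSign f Y * cycleSign f C
  cycleSign-++ {f} {X} {Y} {C} X↭Y++C f↺Y f↺C Y∩C=∅ = begin
    sign (length X) * sign (inversions (graph f X))
      ≡⟨ cong₂ (λ m n → sign m * sign n) length≡ inversions≡ ⟩
    sign (length Y ℕ.+ length C) * sign ((inversions GY ℕ.+ inversions GC) ℕ.+ (crossings GY GC ℕ.+ crossings GC GY))
      ≡⟨ cong₂ _*_ (sign-+ (length Y) (length C))
                   (trans (sign-+ (inversions GY ℕ.+ inversions GC) _)
                          (cong₂ _*_ (sign-+ (inversions GY) (inversions GC)) (sign-crossings-graph f↺Y f↺C Y∩C=∅))) ⟩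
    (sign (length Y) * sign (length C)) * ((sign (inversions GY) * sign (inversions GC)) * 1ℤ)
      ≡⟨ regroup (sign (length Y)) (sign (length C)) (sign (inversions GY)) (sign (inversions GC)) ⟩
    cycleSign f Y * cycleSign f C ∎
    where
      open ≡-Reasoning
      GY = graph f Y
      GC = graph f C
      length≡ : length X ≡ length Y ℕ.+ length C
      length≡ = trans (↭-length X↭Y++C) (Listₚ.length-++ Y)
      inversions≡ : inversions (graph f X) ≡ (inversions GY ℕ.+ inversions GC) ℕ.+ (crossings GY GC ℕ.+ crossings GC GY)
      inversions≡ = trans (inversions-↭ (subst (graph f X ↭_) (Listₚ.map-++ _ Y C) (map⁺ _ X↭Y++C))) (inversions-++ GY GC)
      regroup : ∀ a b c d → (a * b) * ((c * d) * 1ℤ) ≡ (a * c) * (b * d)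
      regroup = solve-∀

  inv≡inversions-graph : ∀ (f : Fin r → Fin r) s → AllPairs Fin._<_ (map f s) → inv s ≡ inversions (graph f s)
  inv≡inversions-graph f [] _ = refl
  inv≡inversions-graph f (x ∷ s) (fx<fs ∷ fs↗) = begin
    countLess x s ℕ.+ inv s
      ≡⟨ cong₂ ℕ._+_ later-smaller (inv≡inversions-graph f s fs↗) ⟩
    sumℕ G (λ e → inversion e e₀) ℕ.+ inversions G
      ≡⟨ cong (ℕ._+ (sumℕ G (λ e → inversion e e₀) ℕ.+ inversions G))
              (trans (cong₂ ℕ._+_ (inversion-self e₀) (sumℕ-zero G (λ e e∈ → from-x e∈))) refl) ⟨
    (inversion e₀ e₀ ℕ.+ sumℕ G (inversion e₀)) ℕ.+ (sumℕ G (λ e → inversion e e₀) ℕ.+ inversions G)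
      ≡⟨ cong ((inversion e₀ e₀ ℕ.+ sumℕ G (inversion e₀)) ℕ.+_)
              (sumℕ-+ G (λ e → inversion e e₀) (λ e → sumℕ G (inversion e))) ⟨
    inversions (e₀ ∷ G) ∎
    where
      open ≡-Reasoning
      G = graph f s
      e₀ = (x , f x)
      fx< : ∀ {y} → y ∈ s → f x Fin.< f y
      fx< y∈ = All.lookup fx<fs (∈-map⁺ f y∈)
      from-x : ∀ {e} → e ∈ G → inversion e₀ e ≡ 0
      from-x e∈ with y , y∈ , refl ← ∈-map⁻ _ e∈ =
        trans (cong (⟦ x < y ⟧ ℕ.*_) (⟦<⟧-no (Finₚ.<-asym (fx< y∈)))) (ℕₚ.*-zeroʳ ⟦ x < y ⟧)
      later-smaller : countLess x s ≡ sumℕ G (λ e → inversion e e₀)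
      later-smaller = trans (countB-sumℕ _ s) (sym (trans (sumℕ-map s _ _)
        (sumℕ-cong s (λ y y∈ → trans (cong (⟦ y < x ⟧ ℕ.*_) (⟦<⟧-yes (fx< y∈))) (ℕₚ.*-identityʳ ⟦ y < x ⟧)))))

  below : Fin r → List (Fin r) → ℕ
  below a L = sumℕ L (λ x → ⟦ x < a ⟧)

  sign-inversions-∷ : ∀ a A (E : Biword r) → a ∉ top E → A ∉ bottom E →
    sign (inversions ((a , A) ∷ E)) ≡ sign (inversions E) * (sign (below a (top E)) * sign (below A (bottom E)))
  sign-inversions-∷ a A E a∉ A∉ = begin
    sign (inversions ([ (a , A) ] ++ E))
      ≡⟨ cong sign (inversions-++ [ (a , A) ] E) ⟩
    sign ((inversions [ (a , A) ] ℕ.+ inversions E) ℕ.+ (crossings [ (a , A) ] E ℕ.+ crossings E [ (a , A) ]))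
      ≡⟨ sign-+ (inversions [ (a , A) ] ℕ.+ inversions E) _ ⟩
    sign (inversions [ (a , A) ] ℕ.+ inversions E) * sign (crossings [ (a , A) ] E ℕ.+ crossings E [ (a , A) ])
      ≡⟨ cong₂ _*_ (cong (λ n → sign (n ℕ.+ 0 ℕ.+ 0 ℕ.+ inversions E)) (inversion-self (a , A)))
                   (trans (sign-crossings [ (a , A) ] E apart) (cong₂ (λ m n → sign m * sign n) (below≡ proj₁) (below≡ proj₂))) ⟩
    sign (inversions E) * (sign (below a (top E)) * sign (below A (bottom E))) ∎
    where
      open ≡-Reasoning
      apart : ∀ {e e′} → e ∈ [ (a , A) ] → e′ ∈ E → proj₁ e ≢ proj₁ e′ × proj₂ e ≢ proj₂ e′
      apart (here refl) e′∈ = (λ { refl → a∉ (∈-map⁺ proj₁ e′∈) }) , (λ { refl → A∉ (∈-map⁺ proj₂ e′∈) })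
      below≡ : ∀ (π : Biletter r → Fin r) → sumℕ E (λ e′ → ⟦ π e′ < π (a , A) ⟧) ℕ.+ 0 ≡ below (π (a , A)) (map π E)
      below≡ π = trans (ℕₚ.+-identityʳ _) (sym (sumℕ-map E π _))

  walk : Fin r → List (Fin r) → Fin r → Biword r
  walk c [] c₀ = (c , c₀) ∷ []
  walk c (d ∷ ds) c₀ = (c , d) ∷ walk d ds c₀

  top-walk : ∀ c ds c₀ → top (walk c ds c₀) ≡ c ∷ ds
  top-walk c [] c₀ = refl
  top-walk c (d ∷ ds) c₀ = cong (c ∷_) (top-walk d ds c₀)

  bottom-walk : ∀ c ds c₀ → bottom (walk c ds c₀) ≡ ds ++ [ c₀ ]
  bottom-walk c [] c₀ = refl
  bottom-walk c (d ∷ ds) c₀ = cong (d ∷_) (bottom-walk d ds c₀)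

  sign-⟦<⟧-pair : ∀ {a b : Fin r} → a ≢ b → sign ⟦ b < a ⟧ * sign ⟦ a < b ⟧ ≡ -1ℤ
  sign-⟦<⟧-pair a≢b with ⟦<⟧-≢ a≢b
  ... | inj₁ (a<b , b≮a) rewrite a<b | b≮a = refl
  ... | inj₂ (a≮b , b<a) rewrite a≮b | b<a = refl

  firstStep : List (Fin r) → Fin r → Fin r
  firstStep [] c₀ = c₀
  firstStep (d ∷ _) _ = d

  walkFrom : List (Fin r) → Fin r → Biword r
  walkFrom [] c₀ = []
  walkFrom (d ∷ ds) c₀ = walk d ds c₀

  walk-∷ : ∀ c ds c₀ → walk c ds c₀ ≡ (c , firstStep ds c₀) ∷ walkFrom ds c₀
  walk-∷ c [] c₀ = refl
  walk-∷ c (d ∷ ds) c₀ = refl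

  top-walkFrom : ∀ ds c₀ → top (walkFrom ds c₀) ≡ ds
  top-walkFrom [] c₀ = refl
  top-walkFrom (d ∷ ds) c₀ = top-walk d ds c₀

  bottom-walkFrom : ∀ ds c₀ → firstStep ds c₀ ∷ bottom (walkFrom ds c₀) ≡ ds ++ [ c₀ ]
  bottom-walkFrom [] c₀ = refl
  bottom-walkFrom (d ∷ ds) c₀ = cong (d ∷_) (bottom-walk d ds c₀)

  sign-inversions-cycle-∷ : ∀ c₀ c₁ rest → Unique (c₀ ∷ c₁ ∷ rest) →
    sign (inversions (walk c₀ (c₁ ∷ rest) c₀)) ≡ - sign (inversions (walk c₀ rest c₀))
  sign-inversions-cycle-∷ c₀ c₁ rest u = begin
    sign (inversions (walk c₀ (c₁ ∷ rest) c₀))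
      ≡⟨ cong (λ δ → sign (inversions ((c₀ , c₁) ∷ δ))) (walk-∷ c₁ rest c₀) ⟩
    sign (inversions ((c₀ , c₁) ∷ (c₁ , n) ∷ E))
      ≡⟨ sign-inversions-∷ c₀ c₁ ((c₁ , n) ∷ E) c₀∉top c₁∉bottom ⟩
    sign (inversions ((c₁ , n) ∷ E)) * (sign (below c₀ (c₁ ∷ top E)) * sign (below c₁ (n ∷ bottom E)))
      ≡⟨ cong₂ _*_ (sign-inversions-∷ c₁ n E c₁∉topE n∉bottomE)
                   (cong₂ _*_ (sign-+ ⟦ c₁ < c₀ ⟧ (below c₀ (top E))) below-c₁) ⟩
    (sign (inversions E) * (a₁ * m)) * ((sign ⟦ c₁ < c₀ ⟧ * a₀) * (a₁ * sign (⟦ c₀ < c₁ ⟧ ℕ.+ 0)))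
      ≡⟨ regroup-signs (sign (inversions E)) a₀ a₁ m (sign ⟦ c₁ < c₀ ⟧) (sign (⟦ c₀ < c₁ ⟧ ℕ.+ 0))
                       (sign-*-self (below c₁ (top E)))
                       (trans (cong (λ k → sign ⟦ c₁ < c₀ ⟧ * sign k) (ℕₚ.+-identityʳ ⟦ c₀ < c₁ ⟧)) (sign-⟦<⟧-pair c₀≢c₁)) ⟩
    - (sign (inversions E) * (a₀ * m))
      ≡⟨ cong -_ (sign-inversions-∷ c₀ n E c₀∉topE n∉bottomE) ⟨
    - sign (inversions ((c₀ , n) ∷ E))
      ≡⟨ cong (λ δ → - sign (inversions δ)) (walk-∷ c₀ rest c₀) ⟨
    - sign (inversions (walk c₀ rest c₀)) ∎
    where
      open ≡-Reasoning
      n = firstStep rest c₀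
      E = walkFrom rest c₀
      a₀ = sign (below c₀ (top E))
      a₁ = sign (below c₁ (top E))
      m = sign (below n (bottom E))
      topE = top-walkFrom rest c₀
      bottomE = bottom-walkFrom rest c₀
      c₀∉ : c₀ ∉ c₁ ∷ rest
      c₀∉ = ∉-of-Unique u
      c₀≢c₁ : c₀ ≢ c₁
      c₀≢c₁ = c₀∉ ∘ here
      Unique-rest-c₀ : Unique (rest ++ [ c₀ ])
      Unique-rest-c₀ = Uniqueₚ.++⁺ (Unique.tail (Unique.tail u)) ([] ∷ []) (λ { (c₀∈rest , here refl) → c₀∉ (there c₀∈rest) })
      n∉bottomE : n ∉ bottom E
      n∉bottomE = ∉-of-Unique (subst Unique (sym bottomE) Unique-rest-c₀)
      c₀∉topE : c₀ ∉ top E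
      c₀∉topE c₀∈ = c₀∉ (there (subst (c₀ ∈_) topE c₀∈))
      c₀∉top : c₀ ∉ top ((c₁ , n) ∷ E)
      c₀∉top (here c₀≡c₁) = c₀≢c₁ c₀≡c₁
      c₀∉top (there c₀∈) = c₀∉topE c₀∈
      c₁∉topE : c₁ ∉ top E
      c₁∉topE c₁∈ = ∉-of-Unique (Unique.tail u) (subst (c₁ ∈_) topE c₁∈)
      c₁∉bottom : c₁ ∉ n ∷ bottom E
      c₁∉bottom c₁∈ with ∈-++⁻ rest (subst (c₁ ∈_) bottomE c₁∈)
      ... | inj₁ c₁∈rest = ∉-of-Unique (Unique.tail u) c₁∈rest
      ... | inj₂ (here c₁≡c₀) = c₀≢c₁ (sym c₁≡c₀)
      below-c₁ : sign (below c₁ (n ∷ bottom E)) ≡ a₁ * sign (⟦ c₀ < c₁ ⟧ ℕ.+ 0)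
      below-c₁ = begin
        sign (below c₁ (n ∷ bottom E))
          ≡⟨ cong (λ L → sign (below c₁ L)) bottomE ⟩
        sign (below c₁ (rest ++ [ c₀ ]))
          ≡⟨ cong sign (sumℕ-++ rest [ c₀ ] (λ x → ⟦ x < c₁ ⟧)) ⟩
        sign (below c₁ rest ℕ.+ (⟦ c₀ < c₁ ⟧ ℕ.+ 0))
          ≡⟨ cong (λ L → sign (below c₁ L ℕ.+ (⟦ c₀ < c₁ ⟧ ℕ.+ 0))) topE ⟨
        sign (below c₁ (top E) ℕ.+ (⟦ c₀ < c₁ ⟧ ℕ.+ 0))
          ≡⟨ sign-+ (below c₁ (top E)) _ ⟩
        a₁ * sign (⟦ c₀ < c₁ ⟧ ℕ.+ 0) ∎

  cycleSign-walk : ∀ c₀ ds → Unique (c₀ ∷ ds) → sign (length (c₀ ∷ ds)) * sign (inversions (walk c₀ ds c₀)) ≡ -1ℤ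
  cycleSign-walk c₀ [] _ = cong (λ n → sign 1 * sign (n ℕ.+ 0 ℕ.+ 0)) (inversion-self (c₀ , c₀))
  cycleSign-walk c₀ (c₁ ∷ rest) u = begin
    - sign (length (c₀ ∷ rest)) * sign (inversions (walk c₀ (c₁ ∷ rest) c₀))
      ≡⟨ cong (λ s → - sign (length (c₀ ∷ rest)) * s) (sign-inversions-cycle-∷ c₀ c₁ rest u) ⟩
    - sign (length (c₀ ∷ rest)) * - sign (inversions (walk c₀ rest c₀))
      ≡⟨ neg-*-neg (sign (length (c₀ ∷ rest))) (sign (inversions (walk c₀ rest c₀))) ⟩
    sign (length (c₀ ∷ rest)) * sign (inversions (walk c₀ rest c₀))
      ≡⟨ cycleSign-walk c₀ rest (All.tail (Unique.head u) ∷ Unique.tail (Unique.tail u)) ⟩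
    -1ℤ ∎
    where
      open ≡-Reasoning
      neg-*-neg : ∀ a b → - a * - b ≡ a * b
      neg-*-neg = solve-∀

-- Cycles of an endofunction

minimal : (P : ℕ → Set) → (∀ n → Dec (P n)) → ∀ {n} → P n → ∃ λ m → P m × (∀ {k} → k ℕ.< m → ¬ P k)
minimal P P? {n} Pn = search 0 (λ ()) n refl
  where
    search : ∀ k → (∀ {j} → j ℕ.< k → ¬ P j) → ∀ t → k ℕ.+ t ≡ n → ∃ λ m → P m × (∀ {j} → j ℕ.< m → ¬ P j)
    search k none-below zero k+0≡n = k , subst P (trans (sym k+0≡n) (ℕₚ.+-identityʳ k)) Pn , none-below
    search k none-below (suc t) k+t≡n with P? k
    ... | yes Pk = k , Pk , none-below
    ... | no ¬Pk = search (suc k) none-below′ t (trans (sym (ℕₚ.+-suc k t)) k+t≡n)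
      where
        none-below′ : ∀ {j} → j ℕ.< suc k → ¬ P j
        none-below′ j<1+k with ℕₚ.m≤n⇒m<n∨m≡n (ℕₚ.≤-pred j<1+k)
        ... | inj₁ j<k = none-below j<k
        ... | inj₂ refl = ¬Pk

module _ {A : Set} (f : A → A) where

  iterate-+ : ∀ x m n → iterate f x (m ℕ.+ n) ≡ iterate f (iterate f x m) n
  iterate-+ x zero n = refl
  iterate-+ x (suc m) n = iterate-+ (f x) m n

  iterate-comm : ∀ x m n → iterate f (iterate f x n) m ≡ iterate f (iterate f x m) n
  iterate-comm x m n = trans (sym (iterate-+ x n m)) (trans (cong (iterate f x) (ℕₚ.+-comm n m)) (iterate-+ x m n))

  return-to-start : ∀ p L → iterate f p (suc L) ≡ p → ∀ {a} → a ℕ.< suc L →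
                    iterate f (iterate f p a) (suc L ℕ.∸ a) ≡ p
  return-to-start p L period {a} a<L =
    trans (sym (iterate-+ p a (suc L ℕ.∸ a))) (trans (cong (iterate f p) (ℕₚ.m+[n∸m]≡n (ℕₚ.<⇒≤ a<L))) period)

  orbit-distinct : ∀ p L → iterate f p (suc L) ≡ p → (∀ {k} → k ℕ.< L → iterate f p (suc k) ≢ p) →
                   ∀ {a b} → a ℕ.< b → b ℕ.< suc L → iterate f p a ≢ iterate f p b
  orbit-distinct p L period minimal-period {a} {b} a<b b<L fᵃp≡fᵇp =
    minimal-period k<L (subst (λ n → iterate f p n ≡ p) (sym 1+k≡b-a) returns)
    where
      q = iterate f p a
      k = ℕ.pred (b ℕ.∸ a)
      1+k≡b-a : suc k ≡ b ℕ.∸ a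
      1+k≡b-a = ℕₚ.suc-pred (b ℕ.∸ a) {{ℕ.>-nonZero (ℕₚ.m<n⇒0<n∸m a<b)}}
      k<L : k ℕ.< L
      k<L = subst (ℕ._≤ L) (sym 1+k≡b-a) (ℕₚ.≤-trans (ℕₚ.m∸n≤m b a) (ℕₚ.≤-pred b<L))
      q-periodic : iterate f q (b ℕ.∸ a) ≡ q
      q-periodic = trans (sym (iterate-+ p a _)) (trans (cong (iterate f p) (ℕₚ.m+[n∸m]≡n (ℕₚ.<⇒≤ a<b))) (sym fᵃp≡fᵇp))
      back = return-to-start p L period (ℕₚ.<-trans a<b b<L)
      returns : iterate f p (b ℕ.∸ a) ≡ p
      returns = begin
        iterate f p (b ℕ.∸ a)                              ≡⟨ cong (λ x → iterate f x (b ℕ.∸ a)) back ⟨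
        iterate f (iterate f q (suc L ℕ.∸ a)) (b ℕ.∸ a)    ≡⟨ iterate-comm q (b ℕ.∸ a) (suc L ℕ.∸ a) ⟩
        iterate f (iterate f q (b ℕ.∸ a)) (suc L ℕ.∸ a)    ≡⟨ cong (λ x → iterate f x (suc L ℕ.∸ a)) q-periodic ⟩
        iterate f q (suc L ℕ.∸ a)                          ≡⟨ back ⟩
        p                                                  ∎
        where open ≡-Reasoning

  ∈-orbit⁻ : ∀ p n {y} → y ∈ List.iterate f p n → ∃ λ k → k ℕ.< n × iterate f p k ≡ y
  ∈-orbit⁻ p (suc n) (here refl) = 0 , ℕ.s≤s ℕ.z≤n , refl
  ∈-orbit⁻ p (suc n) (there y∈) with k , k<n , refl ← ∈-orbit⁻ (f p) n y∈ = suc k , ℕ.s≤s k<n , refl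

  map-orbit : ∀ p n → map f (List.iterate f p n) ≡ List.iterate f (f p) n
  map-orbit p zero = refl
  map-orbit p (suc n) = cong (f p ∷_) (map-orbit (f p) n)

  orbit-suc : ∀ p n → List.iterate f p (suc n) ≡ List.iterate f p n ++ [ iterate f p n ]
  orbit-suc p zero = refl
  orbit-suc p (suc n) = cong (p ∷_) (orbit-suc (f p) n)

  Unique-orbit : ∀ p n → (∀ {a b} → a ℕ.< b → b ℕ.< n → iterate f p a ≢ iterate f p b) → Unique (List.iterate f p n)
  Unique-orbit p zero _ = []
  Unique-orbit p (suc n) distinct =
    All.tabulate p≢ ∷ Unique-orbit (f p) n (λ a<b b<n → distinct (ℕ.s≤s a<b) (ℕ.s≤s b<n))
    where
      p≢ : ∀ {y} → y ∈ List.iterate f (f p) n → p ≢ y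
      p≢ y∈ with k , k<n , refl ← ∈-orbit⁻ (f p) n y∈ = distinct (ℕ.s≤s ℕ.z≤n) (ℕ.s≤s k<n)

module _ {r : ℕ} (f : Fin r → Fin r) where

  graph-orbit : ∀ p n → graph f (List.iterate f p (suc n)) ≡ walk p (List.iterate f (f p) n) (iterate f p (suc n))
  graph-orbit p zero = refl
  graph-orbit p (suc n) = cong ((p , f p) ∷_) (graph-orbit (f p) n)

  record Cycle : Set where
    field
      elements : List (Fin r)
      unique : Unique elements
      permutes : Permutes f elements
      connected : ∀ {x y} → x ∈ elements → y ∈ elements → ∃ λ k → iterate f x k ≡ y
      cycleSign≡-1 : cycleSign f elements ≡ -1ℤ

  cycle-of-period : ∀ p L → iterate f p (suc L) ≡ p → (∀ {k} → k ℕ.< L → iterate f p (suc k) ≢ p) → Cycle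
  cycle-of-period p L period minimal-period = record
    { elements = C
    ; unique = Unique-C
    ; permutes = subst (_↭ C) (sym map-f-C) (↭-sym (∷↭∷ʳ p (List.iterate f (f p) L)))
    ; connected = connected
    ; cycleSign≡-1 = subst (λ δ → sign (length C) * sign (inversions δ) ≡ -1ℤ)
                           (sym (trans (graph-orbit p L) (cong (walk p (List.iterate f (f p) L)) period)))
                           (cycleSign-walk p (List.iterate f (f p) L) Unique-C)
    }
    where
      C = List.iterate f p (suc L)
      Unique-C : Unique C
      Unique-C = Unique-orbit f p (suc L) (orbit-distinct f p L period minimal-period)

      map-f-C : map f C ≡ List.iterate f (f p) L ++ [ p ]
      map-f-C = trans (map-orbit f p (suc L)) (trans (orbit-suc f (f p) L) (cong (λ x → List.iterate f (f p) L ++ [ x ]) period))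

      connected : ∀ {x y} → x ∈ C → y ∈ C → ∃ λ k → iterate f x k ≡ y
      connected x∈ y∈ with i , i<L , refl ← ∈-orbit⁻ f p (suc L) x∈ | j , j<L , refl ← ∈-orbit⁻ f p (suc L) y∈ =
        (suc L ℕ.∸ i) ℕ.+ j ,
        trans (iterate-+ f (iterate f p i) (suc L ℕ.∸ i) j) (cong (λ x → iterate f x j) (return-to-start f p L period i<L))

  periodic-point : ∀ v₀ → ∃ λ i → ∃ λ d → iterate f (iterate f v₀ i) (suc d) ≡ iterate f v₀ i
  periodic-point v₀ with i , j , i<j , fⁱ≡fʲ ← Finₚ.pigeonhole (ℕₚ.n<1+n r) (λ k → iterate f v₀ (Fin.toℕ k)) =
    Fin.toℕ i , ℕ.pred (Fin.toℕ j ℕ.∸ Fin.toℕ i) ,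
    trans (cong (iterate f (iterate f v₀ (Fin.toℕ i))) (ℕₚ.suc-pred _ {{ℕ.>-nonZero (ℕₚ.m<n⇒0<n∸m i<j)}}))
          (trans (sym (iterate-+ f v₀ (Fin.toℕ i) (Fin.toℕ j ℕ.∸ Fin.toℕ i)))
                 (trans (cong (iterate f v₀) (ℕₚ.m+[n∸m]≡n (ℕₚ.<⇒≤ i<j))) (sym fⁱ≡fʲ)))

  cycle-exists : ∀ (V : Fin r → Set) → (∀ {x} → V x → V (f x)) → ∀ {v₀} → V v₀ →
                 ∃ λ (C : Cycle) → ∀ {x} → x ∈ Cycle.elements C → V x
  cycle-exists V V-closed {v₀} Vv₀ with i , d , period ← periodic-point v₀
                                    with L , period-L , minimal-L ←
                                         minimal (λ k → iterate f (iterate f v₀ i) (suc k) ≡ iterate f v₀ i)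
                                                 (λ k → iterate f (iterate f v₀ i) (suc k) Finₚ.≟ iterate f v₀ i) {d} period =
    cycle-of-period (iterate f v₀ i) L period-L minimal-L , V-on-orbit
    where
      V-iterate : ∀ n {x} → V x → V (iterate f x n)
      V-iterate zero Vx = Vx
      V-iterate (suc n) Vx = V-iterate n (V-closed Vx)
      V-on-orbit : ∀ {x} → x ∈ List.iterate f (iterate f v₀ i) (suc L) → V x
      V-on-orbit x∈ with k , _ , refl ← ∈-orbit⁻ f (iterate f v₀ i) (suc L) x∈ = V-iterate k (V-iterate i Vv₀)

-- Toggling a cycle

module _ {r : ℕ} (f : Fin r → Fin r) (C : Cycle f) {J : List (Fin r)} (uJ : Unique J) (f↺J : Permutes f J) where

  open Cycle C renaming (elements to Cs)

  private
    J′ = symDiff Finₚ._≟_ (allFin r) J Cs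

    Unique-J′ : Unique J′
    Unique-J′ = Uniqueₚ.filter⁺ _ (Uniqueₚ.allFin⁺ r)

    ∈J′⁻ : ∀ {x} → x ∈ J′ → (x ∈ J × x ∉ Cs) ⊎ (x ∉ J × x ∈ Cs)
    ∈J′⁻ = ∈-symDiff⁻ Finₚ._≟_ (allFin r)

    ∈J′⁺ : ∀ {x} → (x ∈ J × x ∉ Cs) ⊎ (x ∉ J × x ∈ Cs) → x ∈ J′
    ∈J′⁺ = ∈-symDiff⁺ Finₚ._≟_ (allFin r) (∈-allFin _)

    disjoint-case : (∀ {x} → x ∈ J → x ∉ Cs) → J′ ↭ J ++ Cs
    disjoint-case J∩C=∅ =
      ↭-of-Unique J′ (J ++ Cs) Unique-J′ (Uniqueₚ.++⁺ uJ unique (λ (x∈J , x∈C) → J∩C=∅ x∈J x∈C)) ⊆J++C J++C⊆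
      where
        ⊆J++C : ∀ {x} → x ∈ J′ → x ∈ J ++ Cs
        ⊆J++C x∈ with ∈J′⁻ x∈
        ... | inj₁ (x∈J , _) = ∈-++⁺ˡ x∈J
        ... | inj₂ (_ , x∈C) = ∈-++⁺ʳ J x∈C
        J++C⊆ : ∀ {x} → x ∈ J ++ Cs → x ∈ J′
        J++C⊆ x∈ with ∈-++⁻ J x∈
        ... | inj₁ x∈J = ∈J′⁺ (inj₁ (x∈J , J∩C=∅ x∈J))
        ... | inj₂ x∈C = ∈J′⁺ (inj₂ ((λ x∈J → J∩C=∅ x∈J x∈C) , x∈C))

    iterate-∈J : ∀ k {x} → x ∈ J → iterate f x k ∈ J
    iterate-∈J zero x∈J = x∈J
    iterate-∈J (suc k) x∈J = iterate-∈J k (Permutes-∈ f↺J x∈J)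

    meeting-case : ∀ {x₀} → x₀ ∈ Cs → x₀ ∈ J → (∀ {x} → x ∈ Cs → x ∈ J) × J ↭ J′ ++ Cs
    meeting-case x₀∈C x₀∈J =
      C⊆J , ↭-of-Unique J (J′ ++ Cs) uJ (Uniqueₚ.++⁺ Unique-J′ unique (λ (x∈J′ , x∈C) → J′∩C=∅ x∈J′ x∈C)) J⊆ ⊆J
      where
        C⊆J : ∀ {x} → x ∈ Cs → x ∈ J
        C⊆J x∈C with k , refl ← connected x₀∈C x∈C = iterate-∈J k x₀∈J
        J′∩C=∅ : ∀ {x} → x ∈ J′ → x ∉ Cs
        J′∩C=∅ x∈J′ x∈C with ∈J′⁻ x∈J′
        ... | inj₁ (_ , x∉C) = x∉C x∈C
        ... | inj₂ (x∉J , _) = x∉J (C⊆J x∈C)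
        J⊆ : ∀ {x} → x ∈ J → x ∈ J′ ++ Cs
        J⊆ {x} x∈J with Any.any? (x Finₚ.≟_) Cs
        ... | yes x∈C = ∈-++⁺ʳ J′ x∈C
        ... | no x∉C = ∈-++⁺ˡ (∈J′⁺ (inj₁ (x∈J , x∉C)))
        ⊆J : ∀ {x} → x ∈ J′ ++ Cs → x ∈ J
        ⊆J x∈ with ∈-++⁻ J′ x∈
        ... | inj₂ x∈C = C⊆J x∈C
        ... | inj₁ x∈J′ with ∈J′⁻ x∈J′
        ...   | inj₁ (x∈J , _) = x∈J
        ...   | inj₂ (_ , x∈C) = C⊆J x∈C

  toggle-⊆ : ∀ {x} → x ∈ J′ → x ∈ J ⊎ x ∈ Cs
  toggle-⊆ x∈ with ∈J′⁻ x∈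
  ... | inj₁ (x∈J , _) = inj₁ x∈J
  ... | inj₂ (_ , x∈C) = inj₂ x∈C

  toggle-cycle : Permutes f J′ × cycleSign f J′ ≡ - cycleSign f J
  toggle-cycle with Any.any? (λ x → Any.any? (x Finₚ.≟_) J) Cs
  ... | no C∩J=∅ = f↺J′ , trans (cycleSign-++ J′↭ f↺J permutes J∩C=∅)
                                (trans (cong (cycleSign f J *_) cycleSign≡-1) (times-minus-one (cycleSign f J)))
    where
      J∩C=∅ : ∀ {x} → x ∈ J → x ∉ Cs
      J∩C=∅ x∈J x∈C = C∩J=∅ (Any.map (λ { refl → x∈J }) x∈C)
      J′↭ = disjoint-case J∩C=∅
      f↺J′ : Permutes f J′
      f↺J′ = begin
        map f J′          ↭⟨ map⁺ f J′↭ ⟩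
        map f (J ++ Cs)   ≡⟨ Listₚ.map-++ f J Cs ⟩
        map f J ++ map f Cs ↭⟨ ++⁺ f↺J permutes ⟩
        J ++ Cs           ↭⟨ ↭-sym J′↭ ⟩
        J′                ∎
        where open PermutationReasoning
  ... | yes C∩J≠∅ with x₀ , x₀∈C , x₀∈J ← find C∩J≠∅ with C⊆J , J↭ ← meeting-case x₀∈C x₀∈J = f↺J′ , sign≡
    where
      J′∩C=∅ : ∀ {x} → x ∈ J′ → x ∉ Cs
      J′∩C=∅ x∈J′ x∈C with ∈J′⁻ x∈J′
      ... | inj₁ (_ , x∉C) = x∉C x∈C
      ... | inj₂ (x∉J , _) = x∉J (C⊆J x∈C)
      f↺J′ : Permutes f J′
      f↺J′ = ++-cancelˡ-↭ Cs (begin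
        Cs ++ map f J′          ↭⟨ ++⁺ʳ (map f J′) (↭-sym permutes) ⟩
        map f Cs ++ map f J′    ↭⟨ ++-comm (map f Cs) (map f J′) ⟩
        map f J′ ++ map f Cs    ≡⟨ Listₚ.map-++ f J′ Cs ⟨
        map f (J′ ++ Cs)        ↭⟨ map⁺ f (↭-sym J↭) ⟩
        map f J                 ↭⟨ f↺J ⟩
        J                       ↭⟨ J↭ ⟩
        J′ ++ Cs                ↭⟨ ++-comm J′ Cs ⟩
        Cs ++ J′                ∎)
        where open PermutationReasoning
      sign≡ : cycleSign f J′ ≡ - cycleSign f J
      sign≡ = begin
        cycleSign f J′                      ≡⟨ ℤₚ.neg-involutive (cycleSign f J′) ⟨
        - - cycleSign f J′                  ≡⟨ cong -_ (times-minus-one (cycleSign f J′)) ⟨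
        - (cycleSign f J′ * -1ℤ)            ≡⟨ cong (λ s → - (cycleSign f J′ * s)) cycleSign≡-1 ⟨
        - (cycleSign f J′ * cycleSign f Cs) ≡⟨ cong -_ (cycleSign-++ J↭ f↺J′ permutes J′∩C=∅) ⟨
        - cycleSign f J                     ∎
        where open ≡-Reasoning

-- Coefficients of Ferm × Bos

module _ {r : ℕ} where

  cross : List (Fin r) → List (Fin r) → ℕ
  cross A B = sumℕ A (λ a → countLess a B)

  inv-++ : ∀ (A B : List (Fin r)) → inv (A ++ B) ≡ (inv A ℕ.+ inv B) ℕ.+ cross A B
  inv-++ [] B = sym (ℕₚ.+-identityʳ (inv B))
  inv-++ (a ∷ A) B rewrite countB-++ (λ y → ⌊ y Fin.<? a ⌋) A B | inv-++ A B =
    regroup (countLess a A) (countLess a B) (inv A) (inv B) (cross A B)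
    where regroup : ∀ x y u v w → (x ℕ.+ y) ℕ.+ ((u ℕ.+ v) ℕ.+ w) ≡ ((x ℕ.+ u) ℕ.+ v) ℕ.+ (y ℕ.+ w)
          regroup = solveℕ-∀

  countLess-≤ : ∀ (a : Fin r) A → All (a Fin.≤_) A → countLess a A ≡ 0
  countLess-≤ a [] _ = refl
  countLess-≤ a (y ∷ A) (a≤y ∷ a≤A) =
    trans (countB-∷ _ y A) (cong₂ ℕ._+_ (cong 𝟙 (⌊⌋-no (y Fin.<? a) (ℕₚ.≤⇒≯ a≤y))) (countLess-≤ a A a≤A))

  inv-ascending : ∀ {A : List (Fin r)} → Ascending A → inv A ≡ 0
  inv-ascending [] = refl
  inv-ascending {a ∷ A} (a≤A ∷ A↗) = cong₂ ℕ._+_ (countLess-≤ a A a≤A) (inv-ascending A↗)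

  cross-↭ : ∀ {A A′ B B′ : List (Fin r)} → A ↭ A′ → B ↭ B′ → cross A B ≡ cross A′ B′
  cross-↭ {A} {A′} {B} A↭A′ B↭B′ =
    trans (sumℕ-↭ (λ a → countLess a B) A↭A′) (sumℕ-cong A′ (λ a _ → countB-↭ _ B↭B′))

  ε-config : ∀ {J s} (w : List (Fin r)) → Ascending J → s ↭ J → ε (config J s w) ≡ + inv w - + inv s
  ε-config {J} {s} w J↗ s↭J = begin
    + inv (bottom (config J s w)) - + inv (top (config J s w))
      ≡⟨ cong₂ (λ b t → + inv b - + inv t) (bottom-config J s w s↭J) (top-config J s w s↭J) ⟩
    + inv (J ++ w) - + inv (s ++ sortW w)
      ≡⟨ cong₂ (λ b t → + b - + t) (inv-++ J w) (inv-++ s (sortW w)) ⟩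
    + ((inv J ℕ.+ inv w) ℕ.+ cross J w) - + ((inv s ℕ.+ inv (sortW w)) ℕ.+ cross s (sortW w))
      ≡⟨ cong₂ (λ b t → + ((b ℕ.+ inv w) ℕ.+ cross J w) - + ((inv s ℕ.+ t) ℕ.+ cross s (sortW w)))
               (inv-ascending J↗) (inv-ascending (sortW-ascending w)) ⟩
    + ((0 ℕ.+ inv w) ℕ.+ cross J w) - + ((inv s ℕ.+ 0) ℕ.+ cross s (sortW w))
      ≡⟨ cong (λ c → + ((0 ℕ.+ inv w) ℕ.+ cross J w) - + ((inv s ℕ.+ 0) ℕ.+ c)) (cross-↭ s↭J (sortW-↭ w)) ⟩
    + ((0 ℕ.+ inv w) ℕ.+ cross J w) - + ((inv s ℕ.+ 0) ℕ.+ cross J w)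
      ≡⟨ cancel (inv w) (inv s) (cross J w) ⟩
    + inv w - + inv s ∎
    where
      open ≡-Reasoning
      cancel : ∀ a b x → + ((0 ℕ.+ a) ℕ.+ x) - + ((b ℕ.+ 0) ℕ.+ x) ≡ + a - + b
      cancel a b x rewrite ℕₚ.+-identityʳ b | ℤₚ.pos-+ a x | ℤₚ.pos-+ b x = cancel-ℤ (+ a) (+ b) (+ x)
        where cancel-ℤ : ∀ a b x → (a + x) - (b + x) ≡ a - b
              cancel-ℤ = solve-∀

  exc-config : ∀ J s (w : List (Fin r)) → exc (bi s J) ℕ.+ exc (bos w) ≡ exc (sortByTop (config J s w))
  exc-config J s w = trans (sym (countB-++ _ (bi s J) (bos w))) (sym (countB-↭ _ (sortByTop-↭ (config J s w))))

  εTerm : ℤ → Biword r → Term r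
  εTerm c β = term c (+ exc β) (ε β) β

  normalise-config : ∀ {J s} (w : List (Fin r)) → Ascending J → s ↭ J → (c : ℤ) →
    normalise (term (c * 1ℤ) (+ exc (bi s J) + + exc (bos w)) (- + inv s + + inv w) (config J s w))
      ≡ εTerm c (sortByTop (config J s w))
  normalise-config {J} {s} w J↗ s↭J c
    rewrite ℤₚ.*-identityʳ c | sym (ℤₚ.pos-+ (exc (bi s J)) (exc (bos w))) | exc-config J s w | ε-config w J↗ s↭J =
    cong (λ q → term c (+ exc (sortByTop (config J s w))) q (sortByTop (config J s w))) (cancel (+ inv s) (+ inv w) _)
    where cancel : ∀ a b e → (- a + b) - (b - a) + e ≡ e
          cancel = solve-∀

module _ {A : Set} where

  sumℤ-if : ∀ (b : Bool) (xs : List A) f → sumℤ (if b then xs else []) f ≡ (if b then sumℤ xs f else 0ℤ)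
  sumℤ-if true xs f = refl
  sumℤ-if false xs f = refl

if-*ˡ : ∀ (b : Bool) (k x : ℤ) → (if b then k * x else 0ℤ) ≡ k * (if b then x else 0ℤ)
if-*ˡ true k x = refl
if-*ˡ false k x = sym (ℤₚ.*-zeroʳ k)

module _ {r : ℕ} where

  mulTerm : Term r → Term r → Term r
  mulTerm (term c i j α) (term d k l β) = term (c * d) (i + k) (j + l) (α ++ β)

  sumℤ-*P : ∀ (P Q : Poly r) g → sumℤ (P *P Q) g ≡ sumℤ P (λ t → sumℤ Q (λ t′ → g (mulTerm t t′)))
  sumℤ-*P [] Q g = refl
  sumℤ-*P (term c i j α ∷ P) Q g =
    trans (sumℤ-++ (map _ Q) (P *P Q) g)
          (cong₂ _+_ (trans (sumℤ-map Q _ g) (sumℤ-cong Q (λ { (term d k l β) _ → refl }))) (sumℤ-*P P Q g))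

  sgn : List (Fin r) → List (Fin r) → ℤ
  sgn J s = sign (length J) * sign (inv s)

  productTerm : List (Fin r) → List (Fin r) → List (Fin r) → Term r
  productTerm J s w = term (sgn J s * 1ℤ) (+ exc (bi s J) + + exc (bos w)) (- + inv s + + inv w) (config J s w)

  sumℤ-FermBos : ∀ n (g : Term r → ℤ) → sumℤ (FermBos r n) g ≡
    sumℤ (upTo (suc n)) (λ k → sumℤ (subsets (allFin r)) (λ J →
      if ⌊ length J ℕ.≟ k ⌋ then sumℤ (perms J) (λ s → sumℤ (words r (n ℕ.∸ k)) (λ w → g (productTerm J s w))) else 0ℤ))
  sumℤ-FermBos n g = trans (sumℤ-concatMap (upTo (suc n)) (λ k → Ferm r k *P Bos r (n ℕ.∸ k)) g) (sumℤ-cong (upTo (suc n)) (λ k _ →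
    trans (sumℤ-*P (Ferm r k) (Bos r (n ℕ.∸ k)) g)
    (trans (sumℤ-concatMap (subsets (allFin r)) _ _)
    (sumℤ-cong (subsets (allFin r)) (λ J _ →
      trans (sumℤ-if ⌊ length J ℕ.≟ k ⌋ _ _)
      (cong (λ x → if ⌊ length J ℕ.≟ k ⌋ then x else 0ℤ)
        (trans (sumℤ-map (perms J) _ _) (sumℤ-cong (perms J) (λ s _ → sumℤ-map (words r (n ℕ.∸ k)) _ _)))))))))

  allFin-ascending : AllPairs Fin._<_ (allFin r)
  allFin-ascending = AllPairsₚ.tabulate⁺-< (λ i<j → i<j)

  subsets-ascending : ∀ {J} → J ∈ subsets (allFin r) → AllPairs Fin._<_ J
  subsets-ascending = AllPairs-subsets (allFin r) allFin-ascending

  εCoeff : Biword r → ℤ → ℤ → ℤ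
  εCoeff β i j = coeffTerm (εTerm 1ℤ β) i j β

  coeffTerm-εTerm-self : ∀ c β i j → coeffTerm (εTerm c β) i j β ≡ εCoeff β i j * c
  coeffTerm-εTerm-self c β i j with ⌊ (+ exc β ℤ.≟ i) ×-dec ((ε β ℤ.≟ j) ×-dec (β ≟ᵇ β)) ⌋
  ... | true = sym (ℤₚ.*-identityˡ c)
  ... | false = refl

  coeffTerm-εTerm : ∀ c δ i j β → coeffTerm (εTerm c δ) i j β ≡ εCoeff β i j * (if ⌊ δ ≟ᵇ β ⌋ then c else 0ℤ)
  coeffTerm-εTerm c δ i j β = by-cases (δ ≟ᵇ β)
    where
      by-cases : Dec (δ ≡ β) → coeffTerm (εTerm c δ) i j β ≡ εCoeff β i j * (if ⌊ δ ≟ᵇ β ⌋ then c else 0ℤ)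
      by-cases (yes refl) = trans (coeffTerm-εTerm-self c δ i j) (cong (εCoeff δ i j *_) (sym (if-yes (δ ≟ᵇ δ) refl)))
      by-cases (no δ≢β) =
        trans (if-no ((+ exc δ ℤ.≟ i) ×-dec ((ε δ ℤ.≟ j) ×-dec (δ ≟ᵇ β))) (δ≢β ∘ proj₂ ∘ proj₂))
              (trans (sym (ℤₚ.*-zeroʳ (εCoeff β i j))) (cong (εCoeff β i j *_) (sym (if-no (δ ≟ᵇ β) δ≢β))))

  signedCount : ℕ → Biword r → List (Fin r) → ℕ → ℤ
  signedCount n β J k = sumℤ (perms J) (λ s → sumℤ (words r (n ℕ.∸ k)) (λ w →
                          if ⌊ sortByTop (config J s w) ≟ᵇ β ⌋ then sgn J s else 0ℤ))

  weight : ℕ → Biword r → List (Fin r) → ℤ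
  weight n β J = if ⌊ length J ℕ.≤? n ⌋ then signedCount n β J (length J) else 0ℤ

  sumℤ-upTo-single : ∀ (m n : ℕ) (X : ℕ → ℤ) →
    sumℤ (upTo (suc n)) (λ k → if ⌊ m ℕ.≟ k ⌋ then X k else 0ℤ) ≡ (if ⌊ m ℕ.≤? n ⌋ then X m else 0ℤ)
  sumℤ-upTo-single m n X with m ℕ.≤? n
  ... | yes m≤n = trans (sumℤ-single (upTo (suc n)) m _ (Uniqueₚ.upTo⁺ (suc n)) (∈-upTo⁺ (ℕ.s≤s m≤n))
                          (λ k _ k≢m → if-no (m ℕ.≟ k) (k≢m ∘ sym)))
                        (if-yes (m ℕ.≟ m) refl)
  ... | no m≰n = sumℤ-zero (upTo (suc n)) (λ k k∈ → if-no (m ℕ.≟ k) (λ { refl → m≰n (ℕₚ.≤-pred (∈-upTo⁻ k∈)) }))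

  coeff-normalise-FermBos : ∀ n i j β →
    coeff (map normalise (FermBos r n)) i j β ≡ εCoeff β i j * sumℤ (subsets (allFin r)) (weight n β)
  coeff-normalise-FermBos n i j β = begin
    coeff (map normalise (FermBos r n)) i j β
      ≡⟨ trans (coeff-sum (map normalise (FermBos r n)) i j β) (sumℤ-map (FermBos r n) normalise _) ⟩
    sumℤ (FermBos r n) (λ t → coeffTerm (normalise t) i j β)
      ≡⟨ sumℤ-FermBos n _ ⟩
    sumℤ (upTo (suc n)) (λ k → sumℤ (subsets (allFin r)) (λ J → if ⌊ length J ℕ.≟ k ⌋ then
      sumℤ (perms J) (λ s → sumℤ (words r (n ℕ.∸ k)) (λ w → coeffTerm (normalise (productTerm J s w)) i j β)) else 0ℤ))
      ≡⟨ trans (sumℤ-cong (upTo (suc n)) (λ k _ → trans (sumℤ-cong (subsets (allFin r)) (λ J J∈ → factor-εCoeff k J∈))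
                                                         (sumℤ-*ˡ (subsets (allFin r)) (εCoeff β i j) _)))
               (sumℤ-*ˡ (upTo (suc n)) (εCoeff β i j) _) ⟩
    εCoeff β i j * sumℤ (upTo (suc n)) (λ k → sumℤ (subsets (allFin r)) (λ J →
      if ⌊ length J ℕ.≟ k ⌋ then signedCount n β J k else 0ℤ))
      ≡⟨ cong (εCoeff β i j *_) (sumℤ-comm (upTo (suc n)) (subsets (allFin r)) _) ⟩
    εCoeff β i j * sumℤ (subsets (allFin r)) (λ J → sumℤ (upTo (suc n)) (λ k →
      if ⌊ length J ℕ.≟ k ⌋ then signedCount n β J k else 0ℤ))
      ≡⟨ cong (εCoeff β i j *_) (sumℤ-cong (subsets (allFin r)) (λ J _ → sumℤ-upTo-single (length J) n (signedCount n β J))) ⟩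
    εCoeff β i j * sumℤ (subsets (allFin r)) (weight n β) ∎
    where
      open ≡-Reasoning
      term-coeff : ∀ {J s} w → J ∈ subsets (allFin r) → s ∈ perms J →
                   coeffTerm (normalise (productTerm J s w)) i j β
                   ≡ εCoeff β i j * (if ⌊ sortByTop (config J s w) ≟ᵇ β ⌋ then sgn J s else 0ℤ)
      term-coeff {J} {s} w J∈ s∈ =
        trans (cong (λ t → coeffTerm t i j β)
                    (normalise-config w (AllPairs.map ℕₚ.<⇒≤ (subsets-ascending J∈)) (perms-↭ J s∈) (sgn J s)))
              (coeffTerm-εTerm (sgn J s) (sortByTop (config J s w)) i j β)
      factor-εCoeff : ∀ k {J} → J ∈ subsets (allFin r) →
        (if ⌊ length J ℕ.≟ k ⌋
         then sumℤ (perms J) (λ s → sumℤ (words r (n ℕ.∸ k)) (λ w → coeffTerm (normalise (productTerm J s w)) i j β))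
         else 0ℤ)
          ≡ εCoeff β i j * (if ⌊ length J ℕ.≟ k ⌋ then signedCount n β J k else 0ℤ)
      factor-εCoeff k {J} J∈ = trans
        (cong (λ x → if ⌊ length J ℕ.≟ k ⌋ then x else 0ℤ)
          (trans (sumℤ-cong (perms J) (λ s s∈ → trans (sumℤ-cong (words r (n ℕ.∸ k)) (λ w _ → term-coeff w J∈ s∈))
                                                       (sumℤ-*ˡ (words r (n ℕ.∸ k)) (εCoeff β i j) _)))
                 (sumℤ-*ˡ (perms J) (εCoeff β i j) _)))
        (if-*ˡ ⌊ length J ℕ.≟ k ⌋ (εCoeff β i j) _)

-- The sign-reversing involution

module _ {r : ℕ} (n : ℕ) (β : Biword r) where

  record Realisation (J : List (Fin r)) : Set where
    field
      s w : List (Fin r)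
      s∈perms : s ∈ perms J
      w∈words : w ∈ words r (n ℕ.∸ length J)
      length≤n : length J ℕ.≤ n
      realises : sortByTop (config J s w) ≡ β

  realisation? : ∀ J → Dec (Realisation J)
  realisation? J with length J ℕ.≤? n
                    | Any.any? (λ s → Any.any? (λ w → sortByTop (config J s w) ≟ᵇ β) (words r (n ℕ.∸ length J))) (perms J)
  ... | no |J|≰n | _ = no (|J|≰n ∘ Realisation.length≤n)
  ... | yes _ | no none = no (λ R → let open Realisation R in none (lose s∈perms (lose w∈words realises)))
  ... | yes |J|≤n | yes some with s , s∈ , some-w ← find some with w , w∈ , eq ← find some-w =
    yes (record { s = s ; w = w ; s∈perms = s∈ ; w∈words = w∈ ; length≤n = |J|≤n ; realises = eq })

  weight-unrealisable : ∀ J → ¬ Realisation J → weight n β J ≡ 0ℤ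
  weight-unrealisable J ¬R with length J ℕ.≤? n
  ... | no _ = refl
  ... | yes |J|≤n = sumℤ-zero (perms J) (λ s s∈ → sumℤ-zero (words r (n ℕ.∸ length J)) (λ w w∈ →
        if-no (sortByTop (config J s w) ≟ᵇ β)
              (λ eq → ¬R (record { s = s ; w = w ; s∈perms = s∈ ; w∈words = w∈ ; length≤n = |J|≤n ; realises = eq }))))

  module _ {J : List (Fin r)} (R : Realisation J) where

    open Realisation R

    private
      s↭J = perms-↭ J s∈perms

    realised-length : length β ≡ n
    realised-length = begin
      length β                                 ≡⟨ cong length realises ⟨
      length (sortByTop (config J s w))        ≡⟨ ↭-length (sortByTop-↭ (config J s w)) ⟩
      length (bi s J ++ bos w)                 ≡⟨ Listₚ.length-++ (bi s J) ⟩
      length (bi s J) ℕ.+ length (bos w)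
        ≡⟨ cong₂ ℕ._+_ (length-bi s J (↭-length s↭J)) (length-bi (sortW w) w (length-sortW w)) ⟩
      length s ℕ.+ length (sortW w)
        ≡⟨ cong₂ ℕ._+_ (↭-length s↭J) (trans (length-sortW w) (length-words _ w∈words)) ⟩
      length J ℕ.+ (n ℕ.∸ length J)            ≡⟨ ℕₚ.m+[n∸m]≡n length≤n ⟩
      n                                        ∎
      where open ≡-Reasoning

    realised-ascending : Ascending (top β)
    realised-ascending = subst (Ascending ∘ top) realises (sortByTop-ascending (config J s w))

    realised-balanced : Balanced β
    realised-balanced = subst Balanced realises (config-balanced J s w s↭J)

  module _ {J : List (Fin r)} (J∈ : J ∈ subsets (allFin r)) (R : Realisation J) where

    open Realisation R

    private
      J↗ = subsets-ascending J∈
      uJ : Unique J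
      uJ = AllPairs.map Finₚ.<⇒≢ J↗
      s↭J = perms-↭ J s∈perms

    realised-admissible : Admissible β J
    realised-admissible = subst (λ δ → Admissible δ J) realises (config-admissible uJ s↭J w)

    sgn≡cycleSign : sgn J s ≡ cycleSign (lead β) J
    sgn≡cycleSign = cong (λ k → sign (length J) * sign k) (begin
      inv s                              ≡⟨ inv≡inversions-graph (lead β) s (subst (AllPairs Fin._<_) (sym map-lead) J↗) ⟩
      inversions (graph (lead β) s)      ≡⟨ inversions-↭ (map⁺ _ s↭J) ⟩
      inversions (graph (lead β) J)      ∎)
      where
        open ≡-Reasoning
        map-lead : map (lead β) s ≡ J
        map-lead = subst (λ δ → map (lead δ) s ≡ J) realises (map-lead-config uJ s↭J w)

    weight-realisable : weight n β J ≡ cycleSign (lead β) J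
    weight-realisable = begin
      weight n β J
        ≡⟨ if-yes (length J ℕ.≤? n) length≤n ⟩
      signedCount n β J (length J)
        ≡⟨ sumℤ-single (perms J) s _ (Unique-perms Finₚ._≟_ J uJ) s∈perms (λ s′ s′∈ s′≢s →
             sumℤ-zero (words r (n ℕ.∸ length J)) (λ w′ _ → if-no (sortByTop (config J s′ w′) ≟ᵇ β)
               (λ eq → s′≢s (proj₁ (config-injective uJ (perms-↭ J s′∈) s↭J (trans eq (sym realises))))))) ⟩
      sumℤ (words r (n ℕ.∸ length J)) (λ w′ → if ⌊ sortByTop (config J s w′) ≟ᵇ β ⌋ then sgn J s else 0ℤ)
        ≡⟨ sumℤ-single (words r (n ℕ.∸ length J)) w _ (Unique-words (n ℕ.∸ length J)) w∈words (λ w′ _ w′≢w →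
             if-no (sortByTop (config J s w′) ≟ᵇ β)
               (λ eq → w′≢w (proj₂ (config-injective uJ s↭J s↭J (trans eq (sym realises)))))) ⟩
      (if ⌊ sortByTop (config J s w) ≟ᵇ β ⌋ then sgn J s else 0ℤ)
        ≡⟨ if-yes (sortByTop (config J s w) ≟ᵇ β) realises ⟩
      sgn J s
        ≡⟨ sgn≡cycleSign ⟩
      cycleSign (lead β) J ∎
      where open ≡-Reasoning

  realisation-of-admissible : ∀ {J} → J ∈ subsets (allFin r) → Ascending (top β) → Balanced β → length β ≡ n →
                              Admissible β J → Realisation J
  realisation-of-admissible {J} J∈ β↗ β-balanced |β|≡n adm
    with s , w , s↭J , realises , length≡ ← config-exists β J (subsets-ascending J∈) β↗ β-balanced adm = record
      { s = s ; w = w ; s∈perms = ∈-perms J s↭J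
      ; w∈words = subst (λ m → w ∈ words r m) |w|≡ (∈-words w)
      ; length≤n = subst (length J ℕ.≤_) (trans length≡ |β|≡n) (ℕₚ.m≤m+n (length J) (length w))
      ; realises = realises }
    where
      |w|≡ : length w ≡ n ℕ.∸ length J
      |w|≡ = trans (sym (ℕₚ.m+n∸m≡n (length J) (length w))) (cong (ℕ._∸ length J) (trans length≡ |β|≡n))

  module _ (C : Cycle (lead β)) (C-rows : ∀ {x} → x ∈ Cycle.elements C → row β x ≢ []) where

    toggle : List (Fin r) → List (Fin r)
    toggle J = symDiff Finₚ._≟_ (allFin r) J (Cycle.elements C)

    realisation-toggle : ∀ {J} → J ∈ subsets (allFin r) → Realisation J → Realisation (toggle J)
    realisation-toggle {J} J∈ R =
      realisation-of-admissible (symDiff-∈-subsets Finₚ._≟_ (allFin r) J _)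
        (realised-ascending R) (realised-balanced R) (realised-length R) toggled-admissible
      where
        open Admissible (realised-admissible J∈ R)
        uJ : Unique J
        uJ = AllPairs.map Finₚ.<⇒≢ (subsets-ascending J∈)
        toggled-admissible : Admissible β (toggle J)
        toggled-admissible = record
          { rows-nonempty = λ x∈ → [ rows-nonempty , C-rows ]′ (toggle-⊆ (lead β) C uJ lead-permutes x∈)
          ; lead-permutes = proj₁ (toggle-cycle (lead β) C uJ lead-permutes) }

    weight-toggle : ∀ {J} → J ∈ subsets (allFin r) → weight n β (toggle J) ≡ - weight n β J
    weight-toggle {J} J∈ with realisation? J
    ... | yes R = begin
      weight n β (toggle J)            ≡⟨ weight-realisable (symDiff-∈-subsets Finₚ._≟_ (allFin r) J _) (realisation-toggle J∈ R) ⟩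
      cycleSign (lead β) (toggle J)    ≡⟨ proj₂ (toggle-cycle (lead β) C uJ (Admissible.lead-permutes (realised-admissible J∈ R))) ⟩
      - cycleSign (lead β) J           ≡⟨ cong -_ (weight-realisable J∈ R) ⟨
      - weight n β J                   ∎
      where
        open ≡-Reasoning
        uJ : Unique J
        uJ = AllPairs.map Finₚ.<⇒≢ (subsets-ascending J∈)
    ... | no ¬R with realisation? (toggle J)
    ...   | yes R′ = ⊥-elim (¬R (subst Realisation (symDiff-involutive Finₚ._≟_ (allFin r) J _ (Uniqueₚ.allFin⁺ r) J∈)
                                          (realisation-toggle (symDiff-∈-subsets Finₚ._≟_ (allFin r) J _) R′)))
    ...   | no ¬R′ = trans (weight-unrealisable (toggle J) ¬R′) (sym (cong -_ (weight-unrealisable J ¬R)))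

  lead-row≢[] : Balanced β → ∀ {x} → row β x ≢ [] → row β (lead β x) ≢ []
  lead-row≢[] β-balanced {x} row≢[] with (y , b) , y,b∈ , y≡ ←
    ∈-map⁻ proj₁ (∈-resp-↭ (↭-sym β-balanced) (∈-map⁺ proj₂ (lead-∈ β x row≢[])))
    rewrite y≡ = ∈⇒row≢[] β y,b∈

  sumℤ-weight-nonempty : β ≢ [] → sumℤ (subsets (allFin r)) (weight n β) ≡ 0ℤ
  sumℤ-weight-nonempty β≢[] with Any.any? realisation? (subsets (allFin r))
  ... | no none = sumℤ-zero (subsets (allFin r)) (λ J J∈ → weight-unrealisable J (λ R → none (lose J∈ R)))
  ... | yes some with _ , _ , R₀ ← find some = self-negating (begin
    sumℤ (subsets (allFin r)) (weight n β)
      ≡⟨ sumℤ-symDiff Finₚ._≟_ (allFin r) (Cycle.elements C) (Uniqueₚ.allFin⁺ r) (weight n β) ⟩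
    sumℤ (subsets (allFin r)) (λ J → weight n β (toggle C C-rows J))
      ≡⟨ sumℤ-cong (subsets (allFin r)) (λ J J∈ → weight-toggle C C-rows J∈) ⟩
    sumℤ (subsets (allFin r)) (λ J → - weight n β J)
      ≡⟨ sumℤ-neg (subsets (allFin r)) (weight n β) ⟩
    - sumℤ (subsets (allFin r)) (weight n β) ∎)
    where
      open ≡-Reasoning
      some-row : ∀ (δ : Biword r) → δ ≢ [] → ∃ λ v₀ → row δ v₀ ≢ []
      some-row [] []≢[] = ⊥-elim ([]≢[] refl)
      some-row ((y , b) ∷ δ) _ = y , ∈⇒row≢[] ((y , b) ∷ δ) (here refl)
      cycle = cycle-exists (lead β) (λ x → row β x ≢ []) (lead-row≢[] (realised-balanced R₀)) (proj₂ (some-row β β≢[]))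
      C = proj₁ cycle
      C-rows = proj₂ cycle
      self-negating : ∀ {x} → x ≡ - x → x ≡ 0ℤ
      self-negating {+ zero} _ = refl
      self-negating {+ suc _} ()
      self-negating { ℤ.-[1+ _ ]} ()

module _ {r : ℕ} where

  unit : ℕ → Biword r → ℤ
  unit zero [] = 1ℤ
  unit zero (_ ∷ _) = 0ℤ
  unit (suc _) _ = 0ℤ

  coeff-oneP : ∀ n i j β → coeff (oneP r n) i j β ≡ εCoeff β i j * unit n β
  coeff-oneP zero i j [] = sym (ℤₚ.*-identityʳ (εCoeff [] i j))
  coeff-oneP zero i j (b ∷ β) =
    trans (if-no ((0ℤ ℤ.≟ i) ×-dec ((0ℤ ℤ.≟ j) ×-dec ([] ≟ᵇ (b ∷ β)))) (λ { (_ , _ , ()) }))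
          (sym (ℤₚ.*-zeroʳ (εCoeff (b ∷ β) i j)))
  coeff-oneP (suc n) i j β = sym (ℤₚ.*-zeroʳ (εCoeff β i j))

  sumℤ-weight : ∀ n (β : Biword r) → sumℤ (subsets (allFin r)) (weight n β) ≡ unit n β
  sumℤ-weight n (b ∷ β) = trans (sumℤ-weight-nonempty n (b ∷ β) (λ ())) (zero-unit n)
    where zero-unit : ∀ n → 0ℤ ≡ unit n (b ∷ β)
          zero-unit zero = refl
          zero-unit (suc n) = refl
  sumℤ-weight n [] = trans (sumℤ-subsets-[] (allFin r) (weight n []) only-[]) (weight-[] n)
    where
      empty : ∀ (J : List (Fin r)) → length J ℕ.≤ 0 → J ≡ []
      empty [] _ = refl
      only-[] : ∀ J → J ≢ [] → weight n [] J ≡ 0ℤ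
      only-[] J J≢[] = weight-unrealisable n [] J (λ R →
        J≢[] (empty J (subst (length J ℕ.≤_) (sym (realised-length n [] R)) (Realisation.length≤n R))))
      weight-[] : ∀ n → weight {r} n [] [] ≡ unit n []
      weight-[] zero = refl
      weight-[] (suc n) = weight-unrealisable (suc n) [] [] (λ R → ℕₚ.0≢1+n (realised-length (suc n) ([] {A = Biletter r}) R))

mainTheorem1 : (r : ℕ) → 1 ≤ r → (n : ℕ) → InIdeal (FermBos r n -P oneP r n)
mainTheorem1 r _ n = _≈ᴵ_.inIdeal (≈ᴵ-trans (normalise-≈ᴵ (FermBos r n)) (≈P⇒≈ᴵ coefficients))
  where
    open ≡-Reasoning
    coefficients : map normalise (FermBos r n) ≈P oneP r n
    coefficients i j β = begin
      coeff (map normalise (FermBos r n)) i j β               ≡⟨ coeff-normalise-FermBos n i j β ⟩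
      εCoeff β i j * sumℤ (subsets (allFin r)) (weight n β)   ≡⟨ cong (εCoeff β i j *_) (sumℤ-weight n β) ⟩
      εCoeff β i j * unit n β                                 ≡⟨ coeff-oneP n i j β ⟨
      coeff (oneP r n) i j β                                  ∎
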